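{- Let $\mathcal{A}$ be a finite alphabet with a Bernoulli probability $\mathbf{P}$ on words, and let $w\in\mathcal{A}^+$ with $m=|w|$ and $\pi_w=\mathbf{P}(w)$. Let $\mathcal{K},\mathcal{R},\mathcal{M},\mathcal{U},\mathcal{N}$ be the prefix code and the right, minimal, ultimate and not languages of $w$ with generating functions $\mathcal{K}(z),\mathcal{R}(z),\mathcal{M}(z),\mathcal{U}(z),\mathcal{N}(z)$. Let $o_{n,i}$ be the probability that a random text of length $n$ contains exactly $i$ clumps of $w$, and $\Gamma_n$ the expected number of clumps of $w$ in a random text of length $n$. Then \[ \sum_{n,i}o_{n,i}u^iz^n=\mathcal{N}(z)+\frac{u\,\mathcal{R}(z)\,\mathcal{U}(z)}{1-u\,\mathcal{M}(z)+(u-1)\,\mathcal{K}(z)}, \] and \[ \sum_{n}\Gamma_n z^n=\frac{\mathcal{R}(z)\,\mathcal{U}(z)\,(1-\mathcal{K}(z))}{(1-\mathcal{M}(z))^2}=\frac{\pi_w z^{m}\,(1-\mathcal{K}(z))}{(1-z)^2}. \]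
   Context: Bernoulli model: each letter $a$ has probability $p_a>0$, $\sum_a p_a=1$, $\mathbf{P}(a_1\cdots a_n)=\prod p_{a_i}$; a random text of length $n$ is drawn with probability $\mathbf{P}$. For a language $\mathcal{L}$, $\mathcal{L}(z)=\sum_{x\in\mathcal{L}}\mathbf{P}(x)z^{|x|}$. Autocorrelation set $\mathcal{C}=\{e: |e|<|w|,\ we\in\mathcal{A}^\star w\}$ (contains the empty word $\epsilon$); $\mathcal{C}_\circ=\mathcal{C}\setminus\{\epsilon\}$; $\mathcal{K}=\mathcal{C}_\circ\setminus\mathcal{C}_\circ\mathcal{A}^+$. Right language $\mathcal{R}$: words ending with $w$ in which $w$ occurs only as suffix. Minimal language $\mathcal{M}$: nonempty words $m$ such that $wm$ ends with $w$ and $w$ occurs in $wm$ only as prefix and suffix. Ultimate language $\mathcal{U}$: words $u$ such that $w$ occurs in $wu$ only as prefix. Not language $\mathcal{N}$: words with no occurrence of $w$. Clumps: occurrences of $w$ are identified with the intervals of positions they occupy; two occurrences overlap if the intervals intersect; clumps are the classes of occurrences under the equivalence relation generated by overlapping. -}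

module Defs where

open import Data.Nat using (ℕ; zero; suc; _∸_) renaming (_+_ to _+ℕ_)
open import Data.Nat using ( _≡ᵇ_; _<ᵇ_; _≤ᵇ_)
open import Data.Bool using (Bool; true; false; _∧_; _∨_; not; if_then_else_)
open import Data.Fin using (Fin; _≟_)
open import Data.List using (List; []; _∷_; _++_; length; drop; take; upTo; map; concatMap; filterᵇ; foldr; null)
open import Data.List using (allFin)
open import Data.Bool.ListAction using (all; any)
open import Relation.Nullary using (does)
open import Algebra.Bundles using (CommutativeRing)

-- Formal power series in two variables z, u over a commutative ring.
-- A series F is a function  n i ↦ [z^n u^i] F.

module Series {c ℓ} (R : CommutativeRing c ℓ) where
  open CommutativeRing R

  BS : Set c
  BS = ℕ → ℕ → Carrier

  Σ< : ℕ → (ℕ → Carrier) → Carrier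
  Σ< zero    f = 0#
  Σ< (suc n) f = Σ< n f + f n

  infixl 6 _⊕_ _⊖_
  infixl 7 _⊛_
  infix 4 _≋_

  _⊕_ : BS → BS → BS
  (F ⊕ G) n i = F n i + G n i

  _⊖_ : BS → BS → BS
  (F ⊖ G) n i = F n i + (- G n i)

  _⊛_ : BS → BS → BS
  (F ⊛ G) n i = Σ< (suc n) (λ a → Σ< (suc i) (λ b → F a b * G (n ∸ a) (i ∸ b)))

  𝟙 : BS
  𝟙 n i = if (n ≡ᵇ 0) ∧ (i ≡ᵇ 0) then 1# else 0#

  𝕫 : BS
  𝕫 n i = if (n ≡ᵇ 1) ∧ (i ≡ᵇ 0) then 1# else 0#

  𝕦 : BS
  𝕦 n i = if (n ≡ᵇ 0) ∧ (i ≡ᵇ 1) then 1# else 0#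

  mono : Carrier → ℕ → BS
  mono x m n i = if (n ≡ᵇ m) ∧ (i ≡ᵇ 0) then x else 0#

  _^ₛ_ : BS → ℕ → BS
  F ^ₛ zero  = 𝟙
  F ^ₛ suc j = F ⊛ (F ^ₛ j)

  -- Formal inverse of a series D with [z^0] D = 1 :
  --   1/D = Σ_{j ≥ 0} (1 - D)^j ; since 1 - D has no z^0 term, the
  --   coefficient of z^n only receives contributions from j ≤ n.
  recip : BS → BS
  recip D n i = Σ< (suc n) (λ j → ((𝟙 ⊖ D) ^ₛ j) n i)

  _≋_ : BS → BS → Set ℓ
  F ≋ G = ∀ n i → F n i ≈ G n i

  ofZ : (ℕ → Carrier) → BS
  ofZ f n i = if i ≡ᵇ 0 then f n else 0#

  ℕ→R : ℕ → Carrier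
  ℕ→R zero    = 0#
  ℕ→R (suc n) = 1# + ℕ→R n

module Words (k : ℕ) where

  Word : Set
  Word = List (Fin k)

  words : ℕ → List Word
  words zero    = [] ∷ []
  words (suc n) = concatMap (λ a → map (a ∷_) (words n)) (allFin k)

  isPrefix : Word → Word → Bool
  isPrefix []      _       = true
  isPrefix (_ ∷ _) []      = false
  isPrefix (a ∷ u) (b ∷ v) = does (a ≟ b) ∧ isPrefix u v

  -- w occurs in x at (0-based) position i, i.e. occupies positions i..i+|w|-1
  occursAt : Word → Word → ℕ → Bool
  occursAt w x i = isPrefix w (drop i x)

  positions : Word → List ℕ
  positions x = upTo (suc (length x))

  endsWith : Word → Word → Bool
  endsWith w x = (length w ≤ᵇ length x) ∧ occursAt w x (length x ∸ length w)

  onlyAt : Word → Word → (ℕ → Bool) → Bool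
  onlyAt w x ok = all (λ i → not (occursAt w x i) ∨ ok i) (positions x)

  inN : Word → Word → Bool
  inN w x = all (λ i → not (occursAt w x i)) (positions x)

  inR : Word → Word → Bool
  inR w x = endsWith w x ∧ onlyAt w x (λ i → i ≡ᵇ (length x ∸ length w))

  inM : Word → Word → Bool
  inM w x = not (null x) ∧ endsWith w (w ++ x)
            ∧ onlyAt w (w ++ x) (λ i → (i ≡ᵇ 0) ∨ (i ≡ᵇ length x))

  inU : Word → Word → Bool
  inU w x = onlyAt w (w ++ x) (λ i → i ≡ᵇ 0)

  -- autocorrelation set C, C∘ = C \ {ε}, and K = C∘ \ C∘ A⁺
  inC : Word → Word → Bool
  inC w e = (length e <ᵇ length w) ∧ endsWith w (w ++ e)

  inC∘ : Word → Word → Bool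
  inC∘ w e = not (null e) ∧ inC w e

  -- e ∈ C∘A⁺ iff some proper prefix (take j e, j < |e|) of e lies in C∘
  inK : Word → Word → Bool
  inK w e = inC∘ w e ∧ all (λ j → not (inC∘ w (take j e))) (upTo (length e))

  -- Since clumps are runs of successively overlapping occurrences, the
  -- number of clumps is the number of occurrences overlapping no
  -- earlier occurrence (the first occurrence of each clump).
  clumpStart : Word → Word → ℕ → Bool
  clumpStart w x i = occursAt w x i
    ∧ not (any (λ j → occursAt w x j ∧ (i <ᵇ j +ℕ length w)) (upTo i))

  clumps : Word → Word → ℕ
  clumps w x = length (filterᵇ (clumpStart w x) (positions x))

module Bernoulli {c ℓ} (R : CommutativeRing c ℓ) (k : ℕ) (p : Fin k → CommutativeRing.Carrier R) where
  open CommutativeRing R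
  open Series R
  open Words k public

  sumL : {A : Set} → List A → (A → Carrier) → Carrier
  sumL xs f = foldr (λ x r → f x + r) 0# xs

  sumAlphabet : Carrier
  sumAlphabet = sumL (allFin k) p

  P : Word → Carrier
  P x = foldr (λ a r → p a * r) 1# x

  gf : (Word → Bool) → BS
  gf L = ofZ (λ n → sumL (words n) (λ x → if L x then P x else 0#))

  clumpGF : Word → BS
  clumpGF w n i = sumL (words n) (λ x → if clumps w x ≡ᵇ i then P x else 0#)

  Γ : Word → ℕ → Carrier
  Γ w n = sumL (words n) (λ x → ℕ→R (clumps w x) * P x)

{-# OPTIONS --safe #-}
-- A text either avoids w, or splits uniquely at the end of its last occurrence into a
-- text ending with w followed by a word of U.  A text ending with w either lies in R, or
-- splits uniquely at the end of the previous occurrence into a text ending with w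
-- followed by a word of M, and its last occurrence opens a new clump exactly when that
-- word is not in K.  Marking clumps by u, these decompositions become linear equations
-- between generating functions, solved by inverting 1 − uM + (u − 1)K in the ring of
-- formal power series.  For Γ, the number of clumps of a text is the number of its
-- prefixes that end with a clump-opening occurrence, which relates Γ(1 − z) to R, M and
-- K; with Σ pₐ = 1, Pr(text ends with w) = π_w z^m/(1 − z) and U(1 − z) = 1 − M.
module Submission where

open import Defs
open import Data.Nat using (ℕ; zero; suc; _∸_; _≡ᵇ_; _≤ᵇ_; _<ᵇ_; _<_; _≤_; z≤n; s≤s)
  renaming (_+_ to _+ℕ_)
open import Data.Nat.Properties as ℕ using (n<1+n; ≤-pred; m+[n∸m]≡n)
open import Data.Bool using (Bool; true; false; if_then_else_; _∧_; not)
open import Data.Bool.Properties using (∧-zeroʳ; ∧-identityʳ)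
open import Data.Empty using (⊥-elim)
open import Data.Fin using (Fin; zero; suc; _≟_)
open import Data.Fin.Properties using (suc-injective)
open import Data.List using (List; []; _∷_; _++_; length; take; drop; map; concatMap; tabulate; allFin)
open import Data.List.Properties using (length-++)
open import Data.List.Relation.Unary.All as All using (All; []; _∷_)
open import Data.List.Relation.Unary.All.Properties using (++⁺; map⁺)
open import Data.Product using (_×_; _,_; proj₁; proj₂)
open import Data.Sum using (inj₁; inj₂)
open import Function using (_∘_)
open import Relation.Binary.Definitions using (tri<; tri≈; tri>)
open import Relation.Binary.PropositionalEquality as ≡ using (_≡_; _≢_)
open import Relation.Nullary using (¬_; yes; no)
open import Algebra.Bundles using (CommutativeRing)
open import Algebra.Structures using (IsCommutativeRing)
import Algebra.Properties.AbelianGroup as AbelianGroupProperties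
import Algebra.Properties.CommutativeSemigroup as CommSemigroupProperties
import Algebra.Properties.Ring as RingProperties
import Relation.Binary.Reasoning.Setoid as SetoidReasoning

≡ᵇ-refl : ∀ n → (n ≡ᵇ n) ≡ true
≡ᵇ-refl zero    = ≡.refl
≡ᵇ-refl (suc n) = ≡ᵇ-refl n

≡ᵇ-sym : ∀ m n → (m ≡ᵇ n) ≡ (n ≡ᵇ m)
≡ᵇ-sym zero    zero    = ≡.refl
≡ᵇ-sym zero    (suc n) = ≡.refl
≡ᵇ-sym (suc m) zero    = ≡.refl
≡ᵇ-sym (suc m) (suc n) = ≡ᵇ-sym m n

≢⇒≡ᵇ≡false : ∀ m n → m ≢ n → (m ≡ᵇ n) ≡ false
≢⇒≡ᵇ≡false zero    zero    m≢n = ⊥-elim (m≢n ≡.refl)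
≢⇒≡ᵇ≡false zero    (suc n) _   = ≡.refl
≢⇒≡ᵇ≡false (suc m) zero    _   = ≡.refl
≢⇒≡ᵇ≡false (suc m) (suc n) m≢n = ≢⇒≡ᵇ≡false m n (λ m≡n → m≢n (≡.cong suc m≡n))

≡ᵇ≡true⇒≡ : ∀ m n → (m ≡ᵇ n) ≡ true → m ≡ n
≡ᵇ≡true⇒≡ zero    zero    _ = ≡.refl
≡ᵇ≡true⇒≡ (suc m) (suc n) e = ≡.cong suc (≡ᵇ≡true⇒≡ m n e)

<⇒<ᵇ≡true : ∀ m n → m < n → (m <ᵇ n) ≡ true
<⇒<ᵇ≡true zero    (suc n) _         = ≡.refl
<⇒<ᵇ≡true (suc m) (suc n) (s≤s m<n) = <⇒<ᵇ≡true m n m<n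

≥⇒<ᵇ≡false : ∀ m n → n ≤ m → (m <ᵇ n) ≡ false
≥⇒<ᵇ≡false m       zero    _         = ≡.refl
≥⇒<ᵇ≡false (suc m) (suc n) (s≤s n≤m) = ≥⇒<ᵇ≡false m n n≤m

<ᵇ≡true⇒< : ∀ m n → (m <ᵇ n) ≡ true → m < n
<ᵇ≡true⇒< zero    (suc n) _ = s≤s z≤n
<ᵇ≡true⇒< (suc m) (suc n) e = s≤s (<ᵇ≡true⇒< m n e)

≤⇒≤ᵇ≡true : ∀ m n → m ≤ n → (m ≤ᵇ n) ≡ true
≤⇒≤ᵇ≡true zero    n _   = ≡.refl
≤⇒≤ᵇ≡true (suc m) n m<n = <⇒<ᵇ≡true m n m<n

>⇒≤ᵇ≡false : ∀ m n → n < m → (m ≤ᵇ n) ≡ false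
>⇒≤ᵇ≡false (suc m) n (s≤s n≤m) = ≥⇒<ᵇ≡false m n n≤m

take-length-++ : ∀ {A : Set} (y d : List A) → take (length y) (y ++ d) ≡ y
take-length-++ []      d = ≡.refl
take-length-++ (a ∷ y) d = ≡.cong (a ∷_) (take-length-++ y d)

drop-length-++ : ∀ {A : Set} (y d : List A) → drop (length y) (y ++ d) ≡ d
drop-length-++ []      d = ≡.refl
drop-length-++ (a ∷ y) d = drop-length-++ y d

drop-length-+-++ : ∀ {A : Set} (y d : List A) j → drop (length y +ℕ j) (y ++ d) ≡ drop j d
drop-length-+-++ []      d j = ≡.refl
drop-length-+-++ (a ∷ y) d j = drop-length-+-++ y d j

module Counting where
  open import Data.Nat.Properties
  open import Data.Bool using (_∨_)
  open import Data.Bool.ListAction using (all; any)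
  open import Data.List using (applyUpTo; filterᵇ)
  open import Data.Empty using (⊥)
  open import Data.Product using (Σ)
  open import Relation.Binary.PropositionalEquality as P using (refl; sym; trans; cong)

  false≢true : false ≡ true → ⊥
  false≢true ()

  not≡true⇒≡false : ∀ {b} → not b ≡ true → b ≡ false
  not≡true⇒≡false {false} _ = refl

  ∧≡true⇒ˡ : ∀ {a b} → (a ∧ b) ≡ true → a ≡ true
  ∧≡true⇒ˡ {true} _ = refl

  ∧≡true⇒ʳ : ∀ {a b} → (a ∧ b) ≡ true → b ≡ true
  ∧≡true⇒ʳ {true} a∧b = a∧b

  all≡true⇒ : ∀ (f : ℕ → Bool) (g : ℕ → ℕ) L → all f (applyUpTo g L) ≡ true → ∀ i → i < L → f (g i) ≡ true
  all≡true⇒ f g (suc L) all-f zero    _ with f (g 0) | all-f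
  ... | true | _ = refl
  all≡true⇒ f g (suc L) all-f (suc i) (s≤s i<L) with f (g 0) | all-f
  ... | true | all-f′ = all≡true⇒ f (g ∘ suc) L all-f′ i i<L

  ⇒all≡true : ∀ (f : ℕ → Bool) (g : ℕ → ℕ) L → (∀ i → i < L → f (g i) ≡ true) → all f (applyUpTo g L) ≡ true
  ⇒all≡true f g zero    f-true = refl
  ⇒all≡true f g (suc L) f-true with f (g 0) | f-true 0 (s≤s z≤n)
  ... | true | _ = ⇒all≡true f (g ∘ suc) L (λ i i<L → f-true (suc i) (s≤s i<L))

  all≡false⇒ : ∀ (f : ℕ → Bool) (g : ℕ → ℕ) L → all f (applyUpTo g L) ≡ false → Σ ℕ (λ i → i < L × f (g i) ≡ false)
  all≡false⇒ f g (suc L) not-all with f (g 0) in f₀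
  ... | false = 0 , s≤s z≤n , f₀
  ... | true with all≡false⇒ f (g ∘ suc) L not-all
  ...   | i , i<L , fᵢ = suc i , s≤s i<L , fᵢ

  ⇒any≡false : ∀ (f : ℕ → Bool) (g : ℕ → ℕ) L → (∀ i → i < L → f (g i) ≡ false) → any f (applyUpTo g L) ≡ false
  ⇒any≡false f g zero    f-false = refl
  ⇒any≡false f g (suc L) f-false with f (g 0) | f-false 0 (s≤s z≤n)
  ... | false | _ = ⇒any≡false f (g ∘ suc) L (λ i i<L → f-false (suc i) (s≤s i<L))

  any≡false⇒ : ∀ (f : ℕ → Bool) (g : ℕ → ℕ) L → any f (applyUpTo g L) ≡ false → ∀ i → i < L → f (g i) ≡ false
  any≡false⇒ f g (suc L) no-f zero    _ with f (g 0) | no-f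
  ... | false | _ = refl
  any≡false⇒ f g (suc L) no-f (suc i) (s≤s i<L) with f (g 0) | no-f
  ... | false | no-f′ = any≡false⇒ f (g ∘ suc) L no-f′ i i<L

  any-cong : ∀ (f f′ : ℕ → Bool) (g : ℕ → ℕ) L → (∀ i → i < L → f (g i) ≡ f′ (g i)) →
             any f (applyUpTo g L) ≡ any f′ (applyUpTo g L)
  any-cong f f′ g zero    f≡f′ = refl
  any-cong f f′ g (suc L) f≡f′ =
    P.cong₂ _∨_ (f≡f′ 0 (s≤s z≤n)) (any-cong f f′ (g ∘ suc) L (λ i i<L → f≡f′ (suc i) (s≤s i<L)))

  bit : Bool → ℕ
  bit true  = 1
  bit false = 0

  count : (ℕ → Bool) → ℕ → ℕ
  count f zero    = 0
  count f (suc L) = count f L +ℕ bit (f L)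

  count-head : ∀ f L → count f (suc L) ≡ bit (f 0) +ℕ count (f ∘ suc) L
  count-head f zero    = +-comm 0 (bit (f 0))
  count-head f (suc L) = trans (cong (_+ℕ bit (f (suc L))) (count-head f L)) (+-assoc (bit (f 0)) _ _)

  length-filter≡count : ∀ (f : ℕ → Bool) (g : ℕ → ℕ) L → length (filterᵇ f (applyUpTo g L)) ≡ count (f ∘ g) L
  length-filter≡count f g zero    = refl
  length-filter≡count f g (suc L) with f (g 0) in f₀
  ... | true  = trans (cong suc (length-filter≡count f (g ∘ suc) L)) (sym (trans (count-head (f ∘ g) L) (head-bit f₀)))
    where head-bit = cong (λ b → bit b +ℕ count (f ∘ g ∘ suc) L)
  ... | false = trans (length-filter≡count f (g ∘ suc) L) (sym (trans (count-head (f ∘ g) L) (head-bit f₀)))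
    where head-bit = cong (λ b → bit b +ℕ count (f ∘ g ∘ suc) L)

  count-cong : ∀ f g L → (∀ i → i < L → f i ≡ g i) → count f L ≡ count g L
  count-cong f g zero    f≡g = refl
  count-cong f g (suc L) f≡g =
    P.cong₂ _+ℕ_ (count-cong f g L (λ i i<L → f≡g i (m<n⇒m<1+n i<L))) (cong bit (f≡g L (n<1+n L)))

  count-tail : ∀ f L L′ → L ≤ L′ → (∀ i → L ≤ i → i < L′ → f i ≡ false) → count f L′ ≡ count f L
  count-tail f L L′ L≤L′ f-false with m≤n⇒m<n∨m≡n L≤L′
  ... | inj₂ refl = refl
  ... | inj₁ L<L′ with L′
  ...   | suc L″ = trans (cong (count f L″ +ℕ_) (cong bit (f-false L″ (≤-pred L<L′) (n<1+n L″))))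
                         (trans (+-identityʳ _) (count-tail f L L″ (≤-pred L<L′) (λ i L≤i i<L″ → f-false i L≤i (m<n⇒m<1+n i<L″))))

  count-split : ∀ f a b → count f (a +ℕ b) ≡ count f a +ℕ count (λ i → f (a +ℕ i)) b
  count-split f a zero    = trans (cong (count f) (+-identityʳ a)) (sym (+-identityʳ _))
  count-split f a (suc b) =
    trans (cong (count f) (+-suc a b)) (trans (cong (_+ℕ bit (f (a +ℕ b))) (count-split f a b)) (+-assoc (count f a) _ _))

  count-zero : ∀ f L → (∀ i → i < L → f i ≡ false) → count f L ≡ 0
  count-zero f L f-false = count-tail f 0 L z≤n (λ i _ → f-false i)

  [a∸m]+[n∸a]≡n∸m : ∀ m a n → m ≤ a → a ≤ n → (a ∸ m) +ℕ (n ∸ a) ≡ n ∸ m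
  [a∸m]+[n∸a]≡n∸m m a n m≤a a≤n = +-cancelˡ-≡ m _ _ (trans (sym (+-assoc m (a ∸ m) (n ∸ a)))
    (trans (cong (_+ℕ (n ∸ a)) (m+[n∸m]≡n m≤a)) (trans (m+[n∸m]≡n a≤n) (sym (m+[n∸m]≡n (≤-trans m≤a a≤n))))))

  [ℓ+m]∸[p+m]≡ℓ∸p : ∀ p ℓ m → (ℓ +ℕ m) ∸ (p +ℕ m) ≡ ℓ ∸ p
  [ℓ+m]∸[p+m]≡ℓ∸p p ℓ m = trans (P.cong₂ _∸_ (+-comm ℓ m) (+-comm p m)) ([m+n]∸[m+o]≡n∸o m ℓ p)

open Counting

module FiniteSums {c ℓ} (R : CommutativeRing c ℓ) where
  open CommutativeRing R
  open Series R using (Σ<)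
  open SetoidReasoning setoid
  open CommSemigroupProperties +-commutativeSemigroup using (interchange)

  Σ<-cong-< : ∀ n {f g : ℕ → Carrier} → (∀ j → j < n → f j ≈ g j) → Σ< n f ≈ Σ< n g
  Σ<-cong-< zero    f≈g = refl
  Σ<-cong-< (suc n) f≈g =
    +-cong (Σ<-cong-< n (λ j j<n → f≈g j (ℕ.m<n⇒m<1+n j<n))) (f≈g n (n<1+n n))

  Σ<-cong : ∀ n {f g : ℕ → Carrier} → (∀ j → f j ≈ g j) → Σ< n f ≈ Σ< n g
  Σ<-cong n f≈g = Σ<-cong-< n (λ j _ → f≈g j)

  Σ<-zero : ∀ n {f : ℕ → Carrier} → (∀ j → j < n → f j ≈ 0#) → Σ< n f ≈ 0#
  Σ<-zero zero    f≈0 = refl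
  Σ<-zero (suc n) f≈0 =
    trans (+-cong (Σ<-zero n (λ j j<n → f≈0 j (ℕ.m<n⇒m<1+n j<n))) (f≈0 n (n<1+n n)))
          (+-identityˡ 0#)

  Σ<-distrib-+ : ∀ n (f g : ℕ → Carrier) → Σ< n (λ j → f j + g j) ≈ Σ< n f + Σ< n g
  Σ<-distrib-+ zero    f g = sym (+-identityˡ 0#)
  Σ<-distrib-+ (suc n) f g =
    trans (+-congʳ (Σ<-distrib-+ n f g)) (interchange _ _ _ _)

  *-distribˡ-Σ< : ∀ n x (f : ℕ → Carrier) → x * Σ< n f ≈ Σ< n (λ j → x * f j)
  *-distribˡ-Σ< zero    x f = zeroʳ x
  *-distribˡ-Σ< (suc n) x f = trans (distribˡ x (Σ< n f) (f n)) (+-congʳ (*-distribˡ-Σ< n x f))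

  *-distribʳ-Σ< : ∀ n x (f : ℕ → Carrier) → Σ< n f * x ≈ Σ< n (λ j → f j * x)
  *-distribʳ-Σ< zero    x f = zeroˡ x
  *-distribʳ-Σ< (suc n) x f = trans (distribʳ x (Σ< n f) (f n)) (+-congʳ (*-distribʳ-Σ< n x f))

  Σ<-head : ∀ n (f : ℕ → Carrier) → Σ< (suc n) f ≈ f 0 + Σ< n (λ j → f (suc j))
  Σ<-head zero    f = trans (+-identityˡ (f 0)) (sym (+-identityʳ (f 0)))
  Σ<-head (suc n) f = trans (+-congʳ (Σ<-head n f)) (+-assoc _ _ _)

  Σ<-split : ∀ a b (f : ℕ → Carrier) → Σ< (a +ℕ b) f ≈ Σ< a f + Σ< b (λ j → f (a +ℕ j))
  Σ<-split a zero    f = begin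
    Σ< (a +ℕ 0) f  ≡⟨ ≡.cong (λ k → Σ< k f) (ℕ.+-identityʳ a) ⟩
    Σ< a f         ≈⟨ +-identityʳ _ ⟨
    Σ< a f + 0#    ∎
  Σ<-split a (suc b) f = begin
    Σ< (a +ℕ suc b) f                                 ≡⟨ ≡.cong (λ k → Σ< k f) (ℕ.+-suc a b) ⟩
    Σ< (a +ℕ b) f + f (a +ℕ b)                        ≈⟨ +-congʳ (Σ<-split a b f) ⟩
    (Σ< a f + Σ< b (λ j → f (a +ℕ j))) + f (a +ℕ b)   ≈⟨ +-assoc _ _ _ ⟩
    Σ< a f + Σ< (suc b) (λ j → f (a +ℕ j))            ∎

  Σ<-reverse : ∀ n (f : ℕ → Carrier) → Σ< (suc n) f ≈ Σ< (suc n) (λ a → f (n ∸ a))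
  Σ<-reverse zero    f = refl
  Σ<-reverse (suc n) f = begin
    Σ< (suc n) f + f (suc n)                       ≈⟨ +-congʳ (Σ<-reverse n f) ⟩
    Σ< (suc n) (λ a → f (n ∸ a)) + f (suc n)       ≈⟨ +-comm _ _ ⟩
    f (suc n) + Σ< (suc n) (λ a → f (n ∸ a))       ≈⟨ Σ<-head (suc n) (λ a → f (suc n ∸ a)) ⟨
    Σ< (suc (suc n)) (λ a → f (suc n ∸ a))         ∎

  Σ<-single : ∀ n j₀ (f : ℕ → Carrier) → j₀ < n →
              (∀ j → j < n → j ≢ j₀ → f j ≈ 0#) → Σ< n f ≈ f j₀
  Σ<-single (suc n) j₀ f j₀<1+n f≈0 with ℕ.m≤n⇒m<n∨m≡n (≤-pred j₀<1+n)
  ... | inj₁ j₀<n = trans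
    (+-cong (Σ<-single n j₀ f j₀<n (λ j j<n → f≈0 j (ℕ.m<n⇒m<1+n j<n)))
            (f≈0 n (n<1+n n) (λ n≡j₀ → ℕ.<-irrefl (≡.sym n≡j₀) j₀<n)))
    (+-identityʳ _)
  ... | inj₂ ≡.refl = trans
    (+-congʳ (Σ<-zero n (λ j j<n → f≈0 j (ℕ.m<n⇒m<1+n j<n) (λ j≡n → ℕ.<-irrefl j≡n j<n))))
    (+-identityˡ _)

  Σ<-triangle : ∀ N (ψ : ℕ → ℕ → Carrier) →
    Σ< (suc N) (λ c → Σ< (suc c) (λ a → ψ a (c ∸ a))) ≈
    Σ< (suc N) (λ a → Σ< (suc (N ∸ a)) (λ b → ψ a b))
  Σ<-triangle zero    ψ = refl
  Σ<-triangle (suc N) ψ = begin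
    Σ< (suc N) (λ c → Σ< (suc c) (λ a → ψ a (c ∸ a))) + Σ< (suc (suc N)) (λ a → ψ a (suc N ∸ a))
      ≈⟨ +-congʳ (Σ<-triangle N ψ) ⟩
    Σ< (suc N) row + (Σ< (suc N) (λ a → ψ a (suc N ∸ a)) + ψ (suc N) (N ∸ N))
      ≈⟨ +-assoc _ _ _ ⟨
    (Σ< (suc N) row + Σ< (suc N) (λ a → ψ a (suc N ∸ a))) + ψ (suc N) (N ∸ N)
      ≈⟨ +-congʳ (Σ<-distrib-+ (suc N) _ _) ⟨
    Σ< (suc N) (λ a → row a + ψ a (suc N ∸ a)) + ψ (suc N) (N ∸ N)
      ≈⟨ +-cong (Σ<-cong-< (suc N) extend-row) last-row ⟩
    Σ< (suc N) (λ a → Σ< (suc (suc N ∸ a)) (ψ a)) + Σ< (suc (suc N ∸ suc N)) (ψ (suc N)) ∎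
    where
    row : ℕ → Carrier
    row a = Σ< (suc (N ∸ a)) (ψ a)
    extend-row : ∀ a → a < suc N → row a + ψ a (suc N ∸ a) ≈ Σ< (suc (suc N ∸ a)) (ψ a)
    extend-row a a<1+N rewrite ℕ.+-∸-assoc 1 (≤-pred a<1+N) = refl
    last-row : ψ (suc N) (N ∸ N) ≈ Σ< (suc (N ∸ N)) (ψ (suc N))
    last-row rewrite ℕ.n∸n≡0 N = sym (+-identityˡ _)

module RingLemmas {c ℓ} (R : CommutativeRing c ℓ) where
  open CommutativeRing R
  open SetoidReasoning setoid
  open RingProperties ring using (-0#≈0#; [y-z]x≈yx-zx; x[y-z]≈xy-xz)
  open AbelianGroupProperties +-abelianGroup using (⁻¹-anti-homo‿-; xyx⁻¹≈y; ⁻¹-∙-comm)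
  open CommSemigroupProperties +-commutativeSemigroup using (interchange)

  x-x≈0 : ∀ x → x - x ≈ 0#
  x-x≈0 = -‿inverseʳ

  x+y-y≈x : ∀ x y → (x + y) - y ≈ x
  x+y-y≈x x y = trans (+-assoc x y (- y)) (trans (+-congˡ (x-x≈0 y)) (+-identityʳ x))

  x-0≈x : ∀ x → x - 0# ≈ x
  x-0≈x x = trans (+-congˡ -0#≈0#) (+-identityʳ x)

  x-[x+y]≈-y : ∀ x y → x - (x + y) ≈ - y
  x-[x+y]≈-y x y = begin
    x - (x + y)     ≈⟨ +-congˡ (⁻¹-∙-comm x y) ⟨
    x + (- x - y)   ≈⟨ +-assoc x (- x) (- y) ⟨
    (x - x) - y     ≈⟨ +-congʳ (x-x≈0 x) ⟩
    0# - y          ≈⟨ +-identityˡ (- y) ⟩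
    - y             ∎

  x≈1-[1-x] : ∀ x → x ≈ 1# - (1# - x)
  x≈1-[1-x] x = sym (begin
    1# - (1# - x)   ≈⟨ +-congˡ (⁻¹-anti-homo‿- 1# x) ⟩
    1# + (x - 1#)   ≈⟨ +-assoc 1# x (- 1#) ⟨
    1# + x - 1#     ≈⟨ xyx⁻¹≈y 1# x ⟩
    x               ∎)

  [1-x]+[1-y]x≈1-yx : ∀ x y → (1# - x) + (1# - y) * x ≈ 1# - y * x
  [1-x]+[1-y]x≈1-yx x y = begin
    (1# - x) + (1# - y) * x     ≈⟨ +-congˡ ([y-z]x≈yx-zx x 1# y) ⟩
    (1# - x) + (1# * x - y * x) ≈⟨ +-congˡ (+-congʳ (*-identityˡ x)) ⟩
    (1# - x) + (x - y * x)      ≈⟨ interchange 1# (- x) x (- (y * x)) ⟩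
    (1# + x) + (- x - y * x)    ≈⟨ +-congˡ (⁻¹-∙-comm x (y * x)) ⟩
    (1# + x) - (x + y * x)      ≈⟨ +-congˡ (-‿cong (+-comm x (y * x))) ⟩
    (1# + x) - (y * x + x)      ≈⟨ +-congˡ (⁻¹-∙-comm (y * x) x) ⟨
    (1# + x) + (- (y * x) - x)  ≈⟨ interchange 1# (- (y * x)) x (- x) ⟨
    (1# - y * x) + (x - x)      ≈⟨ +-congˡ (x-x≈0 x) ⟩
    (1# - y * x) + 0#           ≈⟨ +-identityʳ _ ⟩
    1# - y * x                  ∎

  [1-x]+[x-y]≈1-y : ∀ x y → (1# - x) + (x - y) ≈ 1# - y
  [1-x]+[x-y]≈1-y x y = begin
    (1# - x) + (x - y)  ≈⟨ +-assoc 1# (- x) (x - y) ⟩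
    1# + (- x + (x - y)) ≈⟨ +-congˡ (+-assoc (- x) x (- y)) ⟨
    1# + ((- x + x) - y) ≈⟨ +-congˡ (+-congʳ (-‿inverseˡ x)) ⟩
    1# + (0# - y)       ≈⟨ +-congˡ (+-identityˡ (- y)) ⟩
    1# - y              ∎

  x≈r+xy⇒r≈x[1-y] : ∀ x r y → x ≈ r + x * y → r ≈ x * (1# - y)
  x≈r+xy⇒r≈x[1-y] x r y x≈r+xy = sym (begin
    x * (1# - y)        ≈⟨ x[y-z]≈xy-xz x 1# y ⟩
    x * 1# - x * y      ≈⟨ +-congʳ (*-identityʳ x) ⟩
    x - x * y           ≈⟨ +-congʳ x≈r+xy ⟩
    (r + x * y) - x * y ≈⟨ x+y-y≈x r (x * y) ⟩
    r                   ∎)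

  x[1-y]≈x-yx : ∀ x y → x * (1# - y) ≈ x - y * x
  x[1-y]≈x-yx x y = trans (x[y-z]≈xy-xz x 1# y) (+-cong (*-identityʳ x) (-‿cong (*-comm x y)))

  dr≈1⇒dx≈y⇒x≈ry : ∀ d r x y → d * r ≈ 1# → d * x ≈ y → x ≈ r * y
  dr≈1⇒dx≈y⇒x≈ry d r x y dr≈1 dx≈y = begin
    x             ≈⟨ *-identityˡ x ⟨
    1# * x        ≈⟨ *-congʳ (trans (sym dr≈1) (*-comm d r)) ⟩
    (r * d) * x   ≈⟨ *-assoc r d x ⟩
    r * (d * x)   ≈⟨ *-congˡ dx≈y ⟩
    r * y         ∎

module PowerSeries {c ℓ} (R : CommutativeRing c ℓ) where
  open CommutativeRing R hiding (isCommutativeRing)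
  open Series R using (Σ<)
  open FiniteSums R
  open SetoidReasoning setoid

  PS : Set c
  PS = ℕ → Carrier

  infix  4 _≈ₚ_
  infixl 6 _+ₚ_
  infixl 7 _*ₚ_

  _≈ₚ_ : PS → PS → Set ℓ
  f ≈ₚ g = ∀ n → f n ≈ g n

  _+ₚ_ : PS → PS → PS
  (f +ₚ g) n = f n + g n

  -ₚ_ : PS → PS
  (-ₚ f) n = - f n

  0ₚ : PS
  0ₚ n = 0#

  1ₚ : PS
  1ₚ n = if n ≡ᵇ 0 then 1# else 0#

  _*ₚ_ : PS → PS → PS
  (f *ₚ g) n = Σ< (suc n) (λ a → f a * g (n ∸ a))

  *ₚ-cong : ∀ {f f′ g g′} → f ≈ₚ f′ → g ≈ₚ g′ → f *ₚ g ≈ₚ f′ *ₚ g′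
  *ₚ-cong f≈f′ g≈g′ n = Σ<-cong (suc n) (λ a → *-cong (f≈f′ a) (g≈g′ (n ∸ a)))

  *ₚ-identityˡ : ∀ f → 1ₚ *ₚ f ≈ₚ f
  *ₚ-identityˡ f n = begin
    Σ< (suc n) (λ a → 1ₚ a * f (n ∸ a))                  ≈⟨ Σ<-head n _ ⟩
    1# * f n + Σ< n (λ j → 0# * f (n ∸ suc j))           ≈⟨ +-cong (*-identityˡ _) (Σ<-zero n (λ j _ → zeroˡ _)) ⟩
    f n + 0#                                              ≈⟨ +-identityʳ _ ⟩
    f n                                                   ∎

  *ₚ-comm : ∀ f g → f *ₚ g ≈ₚ g *ₚ f
  *ₚ-comm f g n = begin
    Σ< (suc n) (λ a → f a * g (n ∸ a))                   ≈⟨ Σ<-reverse n _ ⟩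
    Σ< (suc n) (λ a → f (n ∸ a) * g (n ∸ (n ∸ a)))       ≈⟨ Σ<-cong-< (suc n) swap ⟩
    Σ< (suc n) (λ a → g a * f (n ∸ a))                   ∎
    where
    swap : ∀ a → a < suc n → f (n ∸ a) * g (n ∸ (n ∸ a)) ≈ g a * f (n ∸ a)
    swap a a<1+n rewrite ℕ.m∸[m∸n]≡n (≤-pred a<1+n) = *-comm _ _

  *ₚ-identityʳ : ∀ f → f *ₚ 1ₚ ≈ₚ f
  *ₚ-identityʳ f n = trans (*ₚ-comm f 1ₚ n) (*ₚ-identityˡ f n)

  *ₚ-distribˡ : ∀ f g h → f *ₚ (g +ₚ h) ≈ₚ f *ₚ g +ₚ f *ₚ h
  *ₚ-distribˡ f g h n = trans (Σ<-cong (suc n) (λ a → distribˡ _ _ _)) (Σ<-distrib-+ (suc n) _ _)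

  *ₚ-distribʳ : ∀ f g h → (g +ₚ h) *ₚ f ≈ₚ g *ₚ f +ₚ h *ₚ f
  *ₚ-distribʳ f g h n = trans (Σ<-cong (suc n) (λ a → distribʳ _ _ _)) (Σ<-distrib-+ (suc n) _ _)

  *ₚ-assoc : ∀ f g h → (f *ₚ g) *ₚ h ≈ₚ f *ₚ (g *ₚ h)
  *ₚ-assoc f g h n = begin
    Σ< (suc n) (λ c → Σ< (suc c) (λ a → f a * g (c ∸ a)) * h (n ∸ c))
      ≈⟨ Σ<-cong (suc n) (λ c → *-distribʳ-Σ< (suc c) _ _) ⟩
    Σ< (suc n) (λ c → Σ< (suc c) (λ a → (f a * g (c ∸ a)) * h (n ∸ c)))
      ≈⟨ Σ<-cong (suc n) (λ c → Σ<-cong-< (suc c) (reassociate c)) ⟩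
    Σ< (suc n) (λ c → Σ< (suc c) (λ a → ψ a (c ∸ a)))
      ≈⟨ Σ<-triangle n ψ ⟩
    Σ< (suc n) (λ a → Σ< (suc (n ∸ a)) (λ b → ψ a b))
      ≈⟨ Σ<-cong (suc n) (λ a → trans (*-distribˡ-Σ< (suc (n ∸ a)) _ _)
                                       (Σ<-cong (suc (n ∸ a)) (regroup a))) ⟨
    Σ< (suc n) (λ a → f a * Σ< (suc (n ∸ a)) (λ b → g b * h ((n ∸ a) ∸ b))) ∎
    where
    ψ : ℕ → ℕ → Carrier
    ψ a b = f a * (g b * h (n ∸ (a +ℕ b)))
    reassociate : ∀ c a → a < suc c → (f a * g (c ∸ a)) * h (n ∸ c) ≈ ψ a (c ∸ a)
    reassociate c a a<1+c rewrite m+[n∸m]≡n (≤-pred a<1+c) = *-assoc _ _ _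
    regroup : ∀ a b → f a * (g b * h ((n ∸ a) ∸ b)) ≈ ψ a b
    regroup a b rewrite ℕ.∸-+-assoc n a b = refl

  isCommutativeRingₚ : IsCommutativeRing _≈ₚ_ _+ₚ_ _*ₚ_ -ₚ_ 0ₚ 1ₚ
  isCommutativeRingₚ = record
    { isRing = record
      { +-isAbelianGroup = record
        { isGroup = record
          { isMonoid = record
            { isSemigroup = record
              { isMagma = record
                { isEquivalence = record
                  { refl  = λ n → refl
                  ; sym   = λ f≈g n → sym (f≈g n)
                  ; trans = λ f≈g g≈h n → trans (f≈g n) (g≈h n)
                  }
                ; ∙-cong = λ f≈f′ g≈g′ n → +-cong (f≈f′ n) (g≈g′ n)
                }
              ; assoc = λ f g h n → +-assoc (f n) (g n) (h n)
              }
            ; identity = (λ f n → +-identityˡ (f n)) , (λ f n → +-identityʳ (f n))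
            }
          ; inverse = (λ f n → -‿inverseˡ (f n)) , (λ f n → -‿inverseʳ (f n))
          ; ⁻¹-cong = λ f≈g n → -‿cong (f≈g n)
          }
        ; comm = λ f g n → +-comm (f n) (g n)
        }
      ; *-cong     = *ₚ-cong
      ; *-assoc    = *ₚ-assoc
      ; *-identity = *ₚ-identityˡ , *ₚ-identityʳ
      ; distrib    = *ₚ-distribˡ , *ₚ-distribʳ
      }
    ; *-comm = *ₚ-comm
    }

  powerSeriesRing : CommutativeRing c ℓ
  powerSeriesRing = record { isCommutativeRing = isCommutativeRingₚ }

  private
    module ℙ = CommutativeRing powerSeriesRing
    module ℙΣ = Series powerSeriesRing
    module ℙLemmas = RingLemmas powerSeriesRing

  infixr 8 _^ₚ_

  _^ₚ_ : PS → ℕ → PS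
  f ^ₚ zero  = 1ₚ
  f ^ₚ suc j = f *ₚ (f ^ₚ j)

  ^ₚ-cong : ∀ {f g} j → f ≈ₚ g → f ^ₚ j ≈ₚ g ^ₚ j
  ^ₚ-cong zero    f≈g = λ n → refl
  ^ₚ-cong (suc j) f≈g = *ₚ-cong f≈g (^ₚ-cong j f≈g)

  recipₚ : PS → PS
  recipₚ d n = Σ< (suc n) (λ j → ((1ₚ ℙ.- d) ^ₚ j) n)

  Σ<ₚ-apply : ∀ k (F : ℕ → PS) n → ℙΣ.Σ< k F n ≡ Σ< k (λ j → F j n)
  Σ<ₚ-apply zero    F n = ≡.refl
  Σ<ₚ-apply (suc k) F n = ≡.cong (_+ F k n) (Σ<ₚ-apply k F n)

  ^ₚ-vanishes-below : ∀ e → e 0 ≈ 0# → ∀ j n → n < j → (e ^ₚ j) n ≈ 0#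
  ^ₚ-vanishes-below e e₀≈0 (suc j) n n<1+j = begin
    Σ< (suc n) (λ a → e a * (e ^ₚ j) (n ∸ a))
      ≈⟨ Σ<-head n _ ⟩
    e 0 * (e ^ₚ j) n + Σ< n (λ a → e (suc a) * (e ^ₚ j) (n ∸ suc a))
      ≈⟨ +-cong (trans (*-congʳ e₀≈0) (zeroˡ _)) (Σ<-zero n later) ⟩
    0# + 0#
      ≈⟨ +-identityˡ _ ⟩
    0# ∎
    where
    later : ∀ a → a < n → e (suc a) * (e ^ₚ j) (n ∸ suc a) ≈ 0#
    later a a<n = trans (*-congˡ (^ₚ-vanishes-below e e₀≈0 j (n ∸ suc a) bound)) (zeroʳ _)
      where
      bound : n ∸ suc a < j
      bound = ℕ.<-≤-trans (ℕ.∸-monoʳ-< (s≤s z≤n) a<n) (≤-pred n<1+j)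

  *ₚ-local : ∀ f g g′ n → (∀ a → a ≤ n → g a ≈ g′ a) → (f *ₚ g) n ≈ (f *ₚ g′) n
  *ₚ-local f g g′ n g≈g′ = Σ<-cong (suc n) (λ a → *-congˡ (g≈g′ (n ∸ a) (ℕ.m∸n≤m n a)))

  geometric-sum : ∀ e k → (1ₚ ℙ.- e) *ₚ ℙΣ.Σ< k (e ^ₚ_) ℙ.≈ 1ₚ ℙ.- e ^ₚ k
  geometric-sum e zero    = ℙ.trans (ℙ.zeroʳ _) (ℙ.sym (ℙLemmas.x-x≈0 1ₚ))
  geometric-sum e (suc k) = ℙ.trans (ℙ.distribˡ (1ₚ ℙ.- e) (ℙΣ.Σ< k (e ^ₚ_)) (e ^ₚ k))
    (ℙ.trans (ℙ.+-congʳ (geometric-sum e k)) (ℙLemmas.[1-x]+[1-y]x≈1-yx (e ^ₚ k) e))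

  *ₚ-recipₚ : ∀ d → d 0 ≈ 1# → d *ₚ recipₚ d ≈ₚ 1ₚ
  *ₚ-recipₚ d d₀≈1 n = begin
    (d *ₚ recipₚ d) n                      ≈⟨ *ₚ-cong {g = recipₚ d} (ℙLemmas.x≈1-[1-x] d) (λ _ → refl) n ⟩
    ((1ₚ ℙ.- e) *ₚ recipₚ d) n             ≈⟨ *ₚ-local (1ₚ ℙ.- e) (recipₚ d) (ℙΣ.Σ< (suc n) (e ^ₚ_)) n truncate ⟩
    ((1ₚ ℙ.- e) *ₚ ℙΣ.Σ< (suc n) (e ^ₚ_)) n ≈⟨ geometric-sum e (suc n) n ⟩
    1ₚ n - (e ^ₚ suc n) n                  ≈⟨ +-congˡ (-‿cong (^ₚ-vanishes-below e e₀≈0 (suc n) n (n<1+n n))) ⟩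
    1ₚ n - 0#                              ≈⟨ RingLemmas.x-0≈x R (1ₚ n) ⟩
    1ₚ n                                   ∎
    where
    e : PS
    e = 1ₚ ℙ.- d
    e₀≈0 : e 0 ≈ 0#
    e₀≈0 = trans (+-congˡ (-‿cong d₀≈1)) (-‿inverseʳ 1#)
    truncate : ∀ a → a ≤ n → recipₚ d a ≈ ℙΣ.Σ< (suc n) (e ^ₚ_) a
    truncate a a≤n = begin
      Σ< (suc a) (λ j → (e ^ₚ j) a)
        ≈⟨ +-identityʳ _ ⟨
      Σ< (suc a) (λ j → (e ^ₚ j) a) + 0#
        ≈⟨ +-congˡ (Σ<-zero (n ∸ a) (λ j _ → ^ₚ-vanishes-below e e₀≈0 (suc a +ℕ j) a (ℕ.m≤m+n (suc a) j))) ⟨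
      Σ< (suc a) (λ j → (e ^ₚ j) a) + Σ< (n ∸ a) (λ j → (e ^ₚ (suc a +ℕ j)) a)
        ≈⟨ Σ<-split (suc a) (n ∸ a) _ ⟨
      Σ< (suc a +ℕ (n ∸ a)) (λ j → (e ^ₚ j) a)
        ≡⟨ ≡.cong (λ k → Σ< (suc k) (λ j → (e ^ₚ j) a)) (m+[n∸m]≡n a≤n) ⟩
      Σ< (suc n) (λ j → (e ^ₚ j) a)
        ≡⟨ Σ<ₚ-apply (suc n) (e ^ₚ_) a ⟨
      ℙΣ.Σ< (suc n) (e ^ₚ_) a ∎

module BivariateSeries {c ℓ} (R : CommutativeRing c ℓ) where
  open CommutativeRing R hiding (zero)
  open Series R
  open FiniteSums R
  open RingLemmas R using (x-0≈x; x-x≈0; x+y-y≈x)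
  open SetoidReasoning setoid

  private
    module Uni = PowerSeries R

  ℙ : CommutativeRing c ℓ
  ℙ = Uni.powerSeriesRing

  module ℙ = CommutativeRing ℙ

  -- 𝔹 = ℙ[[z]] with ℙ = R[[u]]: a bivariate series F is read as n ↦ [zⁿ] F ∈ R[[u]].
  𝔹 : CommutativeRing c ℓ
  𝔹 = PowerSeries.powerSeriesRing ℙ

  module 𝔹 = CommutativeRing 𝔹

  ⊛≈* : ∀ F G → F ⊛ G ≋ F 𝔹.* G
  ⊛≈* F G n i = reflexive (≡.sym (Uni.Σ<ₚ-apply (suc n) (λ a → F a ℙ.* G (n ∸ a)) i))

  𝟙≈1 : 𝟙 ≋ 𝔹.1#
  𝟙≈1 zero    i = refl
  𝟙≈1 (suc n) i = refl

  ^ₛ≈^ₚ : ∀ F j → F ^ₛ j ≋ PowerSeries._^ₚ_ ℙ F j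
  ^ₛ≈^ₚ F zero    = 𝟙≈1
  ^ₛ≈^ₚ F (suc j) = 𝔹.trans (⊛≈* F (F ^ₛ j)) (𝔹.*-congˡ (^ₛ≈^ₚ F j))

  ⊛-constant : ∀ F G → (F ⊛ G) 0 ℙ.≈ F 0 ℙ.* G 0
  ⊛-constant F G i = +-identityˡ _

  ⊛-recip : ∀ D → D 0 ℙ.≈ ℙ.1# → D 𝔹.* recip D 𝔹.≈ 𝔹.1#
  ⊛-recip D D₀≈1 = 𝔹.trans (𝔹.*-congˡ recip≈recipₚ) (PowerSeries.*ₚ-recipₚ ℙ D D₀≈1)
    where
    open PowerSeries ℙ using (_^ₚ_; ^ₚ-cong; recipₚ)
    powers : ∀ j → (𝟙 ⊖ D) ^ₛ j 𝔹.≈ (𝔹.1# 𝔹.- D) ^ₚ j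
    powers j = 𝔹.trans (^ₛ≈^ₚ (𝟙 ⊖ D) j) (^ₚ-cong j (𝔹.+-congʳ 𝟙≈1))
    recip≈recipₚ : recip D 𝔹.≈ recipₚ D
    recip≈recipₚ n i = begin
      Σ< (suc n) (λ j → ((𝟙 ⊖ D) ^ₛ j) n i)       ≈⟨ Σ<-cong (suc n) (λ j → powers j n i) ⟩
      Σ< (suc n) (λ j → ((𝔹.1# 𝔹.- D) ^ₚ j) n i)  ≡⟨ Uni.Σ<ₚ-apply (suc n) (λ j → ((𝔹.1# 𝔹.- D) ^ₚ j) n) i ⟨
      recipₚ D n i                                 ∎

  ⊛-ofZ-coeff : ∀ F g n i → (F ⊛ ofZ g) n i ≈ Σ< (suc n) (λ a → F a i * g (n ∸ a))
  ⊛-ofZ-coeff F g n i = Σ<-cong (suc n) only-b≡i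
    where
    ofZ-shift : ∀ i b → b < suc i → b ≢ i → i ∸ b ≡ suc (i ∸ suc b)
    ofZ-shift zero    zero    _          b≢i = ⊥-elim (b≢i ≡.refl)
    ofZ-shift zero    (suc b) (s≤s ())   _
    ofZ-shift (suc i) zero    _          _   = ≡.refl
    ofZ-shift (suc i) (suc b) (s≤s b<1+i) b≢i = ofZ-shift i b b<1+i (λ b≡i → b≢i (≡.cong suc b≡i))
    only-b≡i : ∀ a → Σ< (suc i) (λ b → F a b * ofZ g (n ∸ a) (i ∸ b)) ≈ F a i * g (n ∸ a)
    only-b≡i a = trans (Σ<-single (suc i) i _ (n<1+n i) off-diagonal) diagonal
      where
      diagonal : F a i * ofZ g (n ∸ a) (i ∸ i) ≈ F a i * g (n ∸ a)
      diagonal rewrite ℕ.n∸n≡0 i = refl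
      off-diagonal : ∀ b → b < suc i → b ≢ i → F a b * ofZ g (n ∸ a) (i ∸ b) ≈ 0#
      off-diagonal b b<1+i b≢i rewrite ofZ-shift i b b<1+i b≢i = zeroʳ _

  mono⊛-coeff : ∀ x m F n i → (mono x m ⊛ F) n i ≈ (if m ≤ᵇ n then x * F (n ∸ m) i else 0#)
  mono⊛-coeff x m F n i with ℕ.≤-<-connex m n
  ... | inj₁ m≤n rewrite ≤⇒≤ᵇ≡true m n m≤n = begin
    Σ< (suc n) (λ a → Σ< (suc i) (λ b → mono x m a b * F (n ∸ a) (i ∸ b)))
      ≈⟨ Σ<-single (suc n) m _ (s≤s m≤n) (λ a _ a≢m → Σ<-zero (suc i) (λ b _ → outside a b a≢m)) ⟩
    Σ< (suc i) (λ b → mono x m m b * F (n ∸ m) (i ∸ b))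
      ≈⟨ Σ<-head i _ ⟩
    mono x m m 0 * F (n ∸ m) i + Σ< i (λ b → mono x m m (suc b) * F (n ∸ m) (i ∸ suc b))
      ≈⟨ +-cong (*-congʳ (reflexive (≡.cong (λ t → if t ∧ true then x else 0#) (≡ᵇ-refl m))))
                (Σ<-zero i (λ b _ → trans (*-congʳ (reflexive (≡.cong (λ t → if t ∧ false then x else 0#) (≡ᵇ-refl m))))
                                          (zeroˡ _))) ⟩
    x * F (n ∸ m) i + 0#
      ≈⟨ +-identityʳ _ ⟩
    x * F (n ∸ m) i ∎
    where
    outside : ∀ a b → a ≢ m → mono x m a b * F (n ∸ a) (i ∸ b) ≈ 0#
    outside a b a≢m rewrite ≢⇒≡ᵇ≡false a m a≢m = zeroˡ _
  ... | inj₂ n<m rewrite >⇒≤ᵇ≡false m n n<m =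
    Σ<-zero (suc n) (λ a a<1+n → Σ<-zero (suc i) (λ b _ → outside a b (a≢m a a<1+n)))
    where
    a≢m : ∀ a → a < suc n → a ≢ m
    a≢m a a<1+n ≡.refl = ℕ.<-irrefl ≡.refl (ℕ.<-≤-trans n<m (≤-pred a<1+n))
    outside : ∀ a b → a ≢ m → mono x m a b * F (n ∸ a) (i ∸ b) ≈ 0#
    outside a b a≢m rewrite ≢⇒≡ᵇ≡false a m a≢m = zeroˡ _

  𝕦⊛-coeff-0 : ∀ F n → (𝕦 ⊛ F) n 0 ≈ 0#
  𝕦⊛-coeff-0 F n = Σ<-zero (suc n) (λ a _ → trans (+-identityˡ _) (no-u⁰ a))
    where
    no-u⁰ : ∀ a → 𝕦 a 0 * F (n ∸ a) 0 ≈ 0#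
    no-u⁰ a rewrite ∧-zeroʳ (a ≡ᵇ 0) = zeroˡ _

  𝕦⊛-coeff-suc : ∀ F n i → (𝕦 ⊛ F) n (suc i) ≈ F n i
  𝕦⊛-coeff-suc F n i = begin
    Σ< (suc n) (λ a → Σ< (suc (suc i)) (λ b → 𝕦 a b * F (n ∸ a) (suc i ∸ b)))
      ≈⟨ Σ<-single (suc n) 0 _ (s≤s z≤n) (λ a _ a≢0 → Σ<-zero (suc (suc i)) (λ b _ → positive a b a≢0)) ⟩
    Σ< (suc (suc i)) (λ b → 𝕦 0 b * F n (suc i ∸ b))
      ≈⟨ Σ<-single (suc (suc i)) 1 _ (s≤s (s≤s z≤n)) (λ b _ b≢1 → off b b≢1) ⟩
    1# * F n i
      ≈⟨ *-identityˡ _ ⟩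
    F n i ∎
    where
    positive : ∀ a b → a ≢ 0 → 𝕦 a b * F (n ∸ a) (suc i ∸ b) ≈ 0#
    positive a b a≢0 rewrite ≢⇒≡ᵇ≡false a 0 a≢0 = zeroˡ _
    off : ∀ b → b ≢ 1 → 𝕦 0 b * F n (suc i ∸ b) ≈ 0#
    off b b≢1 rewrite ≢⇒≡ᵇ≡false b 1 b≢1 = zeroˡ _

  Δ : (ℕ → Carrier) → ℕ → Carrier
  Δ f zero    = f 0
  Δ f (suc n) = f (suc n) - f n

  ⊛[𝟙⊖𝕫]≈⊖𝕫⊛ : ∀ X → X ⊛ (𝟙 ⊖ 𝕫) ≋ X ⊖ 𝕫 ⊛ X
  ⊛[𝟙⊖𝕫]≈⊖𝕫⊛ X = 𝔹.trans (⊛≈* X (𝟙 ⊖ 𝕫))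
    (𝔹.trans (𝔹.*-congˡ {X} (𝔹.+-congʳ {𝔹.- 𝕫} 𝟙≈1))
      (𝔹.trans (RingLemmas.x[1-y]≈x-yx 𝔹 X 𝕫) (𝔹.+-congˡ {X} (𝔹.-‿cong (𝔹.sym (⊛≈* 𝕫 X))))))

  ofZ-⊛[𝟙⊖𝕫] : ∀ f → ofZ f ⊛ (𝟙 ⊖ 𝕫) ≋ ofZ (Δ f)
  ofZ-⊛[𝟙⊖𝕫] f n i = trans (⊛[𝟙⊖𝕫]≈⊖𝕫⊛ (ofZ f) n i)
    (trans (+-congˡ (-‿cong (mono⊛-coeff 1# 1 (ofZ f) n i))) (by-cases n i))
    where
    by-cases : ∀ n i → ofZ f n i - (if 1 ≤ᵇ n then 1# * ofZ f (n ∸ 1) i else 0#) ≈ ofZ (Δ f) n i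
    by-cases zero    zero    = x-0≈x (f 0)
    by-cases (suc n) zero    = +-congˡ (-‿cong (*-identityˡ _))
    by-cases zero    (suc i) = x-0≈x 0#
    by-cases (suc n) (suc i) = trans (+-congˡ (-‿cong (zeroʳ _))) (x-0≈x 0#)

  ofZ-cong : ∀ {f g} → (∀ n → f n ≈ g n) → ofZ f ≋ ofZ g
  ofZ-cong f≈g n zero    = f≈g n
  ofZ-cong f≈g n (suc i) = refl

  Δ-Σ< : ∀ {f} g → (∀ n → f n ≈ Σ< (suc n) g) → ∀ n → Δ f n ≈ g n
  Δ-Σ< g f≈Σg zero    = trans (f≈Σg 0) (+-identityˡ _)
  Δ-Σ< g f≈Σg (suc n) = trans (+-cong (f≈Σg (suc n)) (-‿cong (f≈Σg n)))
    (trans (+-congʳ (+-comm _ _)) (x+y-y≈x (g (suc n)) _))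

  𝟙⊖ofZ : ∀ g → 𝟙 ⊖ ofZ g ≋ ofZ (λ n → (if n ≡ᵇ 0 then 1# else 0#) - g n)
  𝟙⊖ofZ g n zero    rewrite ∧-identityʳ (n ≡ᵇ 0) = refl
  𝟙⊖ofZ g n (suc i) rewrite ∧-zeroʳ (n ≡ᵇ 0) = x-0≈x 0#

  mono≈ofZ : ∀ x m → mono x m ≋ ofZ (λ n → if n ≡ᵇ m then x else 0#)
  mono≈ofZ x m n zero    rewrite ∧-identityʳ (n ≡ᵇ m) = refl
  mono≈ofZ x m n (suc i) rewrite ∧-zeroʳ (n ≡ᵇ m) = refl

  ⊛-distribˡ-⊖ : ∀ F G H → F ⊛ (G ⊖ H) ≋ F ⊛ G ⊖ F ⊛ H
  ⊛-distribˡ-⊖ F G H = 𝔹.trans (⊛≈* F (G ⊖ H)) (𝔹.trans (x[y-z]≈xy-xz F G H)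
    (𝔹.+-cong (𝔹.sym (⊛≈* F G)) (𝔹.-‿cong (𝔹.sym (⊛≈* F H)))))
    where open RingProperties 𝔹.ring using (x[y-z]≈xy-xz)

  ofZ-⊛-ofZ : ∀ f g → ofZ f ⊛ ofZ g ≋ ofZ (λ n → Σ< (suc n) (λ a → f a * g (n ∸ a)))
  ofZ-⊛-ofZ f g n zero    = ⊛-ofZ-coeff (ofZ f) g n 0
  ofZ-⊛-ofZ f g n (suc i) = trans (⊛-ofZ-coeff (ofZ f) g n (suc i)) (Σ<-zero (suc n) (λ a _ → zeroˡ _))

  ofZ-⊕-ofZ : ∀ f g → ofZ f ⊕ ofZ g ≋ ofZ (λ n → f n + g n)
  ofZ-⊕-ofZ f g n zero    = refl
  ofZ-⊕-ofZ f g n (suc i) = +-identityˡ 0#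

  ofZ-⊖-ofZ : ∀ f g → ofZ f ⊖ ofZ g ≋ ofZ (λ n → f n - g n)
  ofZ-⊖-ofZ f g n zero    = refl
  ofZ-⊖-ofZ f g n (suc i) = x-x≈0 0#

  Δ-cong : ∀ {f g} → (∀ n → f n ≈ g n) → ∀ n → Δ f n ≈ Δ g n
  Δ-cong f≈g zero    = f≈g 0
  Δ-cong f≈g (suc n) = +-cong (f≈g (suc n)) (-‿cong (f≈g n))

  Δ-step : ∀ x m n → Δ (λ n → if m ≤ᵇ n then x else 0#) n ≈ (if n ≡ᵇ m then x else 0#)
  Δ-step x zero    zero    = refl
  Δ-step x (suc m) zero    = refl
  Δ-step x m (suc n) with ℕ.<-cmp (suc n) m
  ... | tri< 1+n<m _ _ rewrite >⇒≤ᵇ≡false m (suc n) 1+n<m | >⇒≤ᵇ≡false m n (ℕ.<-trans (n<1+n n) 1+n<m)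
                             | ≢⇒≡ᵇ≡false (suc n) m (ℕ.<⇒≢ 1+n<m) = x-x≈0 0#
  ... | tri≈ _ ≡.refl _ rewrite ≤⇒≤ᵇ≡true (suc n) (suc n) ℕ.≤-refl | >⇒≤ᵇ≡false (suc n) n (n<1+n n)
                             | ≡ᵇ-refl n = x-0≈x x
  ... | tri> _ _ m<1+n rewrite ≤⇒≤ᵇ≡true m (suc n) (ℕ.<⇒≤ m<1+n) | ≤⇒≤ᵇ≡true m n (≤-pred m<1+n)
                             | ≢⇒≡ᵇ≡false (suc n) m (ℕ.<⇒≢ m<1+n ∘ ≡.sym) = x-x≈0 x

  ⊛-constant-zero : ∀ F G → G 0 ℙ.≈ ℙ.0# → (F ⊛ G) 0 ℙ.≈ ℙ.0#
  ⊛-constant-zero F G G₀≈0 = ℙ.trans (⊛-constant F G) (ℙ.trans (ℙ.*-congˡ {F 0} G₀≈0) (ℙ.zeroʳ (F 0)))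

  𝟙⊖-constant : ∀ F → F 0 ℙ.≈ ℙ.0# → (𝟙 ⊖ F) 0 ℙ.≈ ℙ.1#
  𝟙⊖-constant F F₀≈0 = ℙ.trans (ℙ.+-congˡ {ℙ.1#} (ℙ.-‿cong F₀≈0)) (RingLemmas.x-0≈x ℙ ℙ.1#)

  ⊛-constant-one : ∀ F G → F 0 ℙ.≈ ℙ.1# → G 0 ℙ.≈ ℙ.1# → (F ⊛ G) 0 ℙ.≈ ℙ.1#
  ⊛-constant-one F G F₀≈1 G₀≈1 =
    ℙ.trans (⊛-constant F G) (ℙ.trans (ℙ.*-cong F₀≈1 G₀≈1) (ℙ.*-identityˡ ℙ.1#))

  divide-by-recip : ∀ D X Y → D 0 ℙ.≈ ℙ.1# → D 𝔹.* X 𝔹.≈ Y → X 𝔹.≈ Y ⊛ recip D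
  divide-by-recip D X Y D₀≈1 D*X≈Y = 𝔹.trans
    (RingLemmas.dr≈1⇒dx≈y⇒x≈ry 𝔹 D (recip D) X Y (⊛-recip D D₀≈1) D*X≈Y)
    (𝔹.trans (𝔹.*-comm (recip D) Y) (𝔹.sym (⊛≈* Y (recip D))))

module WordSums {c ℓ} (R : CommutativeRing c ℓ) (k : ℕ) (p : Fin k → CommutativeRing.Carrier R) where
  open CommutativeRing R hiding (zero)
  open Series R using (Σ<)
  open FiniteSums R
  open Bernoulli R k p
  open SetoidReasoning setoid
  open RingProperties ring using (-0#≈0#; -‿distribʳ-*)
  open CommSemigroupProperties +-commutativeSemigroup using (interchange)
  open CommSemigroupProperties *-commutativeSemigroup using () renaming (interchange to *-interchange)

  sumL-cong : ∀ {A : Set} (xs : List A) {f g : A → Carrier} → (∀ x → f x ≈ g x) → sumL xs f ≈ sumL xs g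
  sumL-cong []       f≈g = refl
  sumL-cong (x ∷ xs) f≈g = +-cong (f≈g x) (sumL-cong xs f≈g)

  sumL-cong-All : ∀ {A : Set} {Q : A → Set} {xs : List A} {f g : A → Carrier} →
                  All Q xs → (∀ x → Q x → f x ≈ g x) → sumL xs f ≈ sumL xs g
  sumL-cong-All []         f≈g = refl
  sumL-cong-All (qx ∷ qxs) f≈g = +-cong (f≈g _ qx) (sumL-cong-All qxs f≈g)

  sumL-zero : ∀ {A : Set} (xs : List A) {f : A → Carrier} → (∀ x → f x ≈ 0#) → sumL xs f ≈ 0#
  sumL-zero []       f≈0 = refl
  sumL-zero (x ∷ xs) f≈0 = trans (+-cong (f≈0 x) (sumL-zero xs f≈0)) (+-identityˡ 0#)

  sumL-++ : ∀ {A : Set} (xs ys : List A) f → sumL (xs ++ ys) f ≈ sumL xs f + sumL ys f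
  sumL-++ []       ys f = sym (+-identityˡ _)
  sumL-++ (x ∷ xs) ys f = trans (+-congˡ (sumL-++ xs ys f)) (sym (+-assoc _ _ _))

  sumL-map : ∀ {A B : Set} (h : A → B) (xs : List A) f → sumL (map h xs) f ≡ sumL xs (λ x → f (h x))
  sumL-map h []       f = ≡.refl
  sumL-map h (x ∷ xs) f = ≡.cong (f (h x) +_) (sumL-map h xs f)

  sumL-concatMap : ∀ {A B : Set} (g : A → List B) (xs : List A) f →
                   sumL (concatMap g xs) f ≈ sumL xs (λ x → sumL (g x) f)
  sumL-concatMap g []       f = refl
  sumL-concatMap g (x ∷ xs) f = trans (sumL-++ (g x) _ f) (+-congˡ (sumL-concatMap g xs f))

  sumL-distrib-+ : ∀ {A : Set} (xs : List A) f g → sumL xs (λ x → f x + g x) ≈ sumL xs f + sumL xs g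
  sumL-distrib-+ []       f g = sym (+-identityˡ 0#)
  sumL-distrib-+ (x ∷ xs) f g = trans (+-congˡ (sumL-distrib-+ xs f g)) (interchange _ _ _ _)

  *-distribˡ-sumL : ∀ {A : Set} (xs : List A) x f → x * sumL xs f ≈ sumL xs (λ y → x * f y)
  *-distribˡ-sumL []       x f = zeroʳ x
  *-distribˡ-sumL (y ∷ xs) x f = trans (distribˡ _ _ _) (+-congˡ (*-distribˡ-sumL xs x f))

  *-distribʳ-sumL : ∀ {A : Set} (xs : List A) x f → sumL xs f * x ≈ sumL xs (λ y → f y * x)
  *-distribʳ-sumL []       x f = zeroˡ x
  *-distribʳ-sumL (y ∷ xs) x f = trans (distribʳ _ _ _) (+-congˡ (*-distribʳ-sumL xs x f))

  -‿distrib-sumL : ∀ {A : Set} (xs : List A) f → - sumL xs f ≈ sumL xs (λ x → - f x)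
  -‿distrib-sumL []       f = -0#≈0#
  -‿distrib-sumL (x ∷ xs) f =
    trans (sym (RingProperties.-‿+-comm ring _ _)) (+-congˡ (-‿distrib-sumL xs f))

  sumL-Σ<-comm : ∀ {A : Set} (xs : List A) n (f : A → ℕ → Carrier) →
                 sumL xs (λ x → Σ< n (f x)) ≈ Σ< n (λ a → sumL xs (λ x → f x a))
  sumL-Σ<-comm []       n f = sym (Σ<-zero n (λ _ _ → refl))
  sumL-Σ<-comm (x ∷ xs) n f = trans (+-congˡ (sumL-Σ<-comm xs n f)) (sym (Σ<-distrib-+ n _ _))

  sumL-tabulate-zero : ∀ {X : Set} n (f : Fin n → X) (h : X → Carrier) →
                       (∀ c → h (f c) ≈ 0#) → sumL (tabulate f) h ≈ 0#
  sumL-tabulate-zero zero    f h h≈0 = refl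
  sumL-tabulate-zero (suc n) f h h≈0 =
    trans (+-cong (h≈0 zero) (sumL-tabulate-zero n (λ c → f (suc c)) h (λ c → h≈0 (suc c)))) (+-identityˡ 0#)

  sumL-tabulate-single : ∀ {X : Set} n (f : Fin n → X) (h : X → Carrier) (a : Fin n) →
                         (∀ c → c ≢ a → h (f c) ≈ 0#) → sumL (tabulate f) h ≈ h (f a)
  sumL-tabulate-single (suc n) f h zero    h≈0 =
    trans (+-congˡ (sumL-tabulate-zero n (λ c → f (suc c)) h (λ c → h≈0 (suc c) (λ ())))) (+-identityʳ _)
  sumL-tabulate-single (suc n) f h (suc a) h≈0 =
    trans (+-cong (h≈0 zero (λ ()))
                  (sumL-tabulate-single n (λ c → f (suc c)) h a (λ c c≢a → h≈0 (suc c) (c≢a ∘ suc-injective))))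
          (+-identityˡ _)

  words-length : ∀ n → All (λ x → length x ≡ n) (words n)
  words-length zero    = ≡.refl ∷ []
  words-length (suc n) = go (allFin k)
    where
    go : ∀ (cs : List (Fin k)) → All (λ x → length x ≡ suc n) (concatMap (λ a → map (a ∷_) (words n)) cs)
    go []       = []
    go (c ∷ cs) = ++⁺ (map⁺ (All.map (≡.cong suc) (words-length n))) (go cs)

  sumL-words-∷ : ∀ n (f : Word → Carrier) → sumL (words (suc n)) f ≈ sumL (allFin k) (λ c → sumL (words n) (λ x → f (c ∷ x)))
  sumL-words-∷ n f = trans (sumL-concatMap _ (allFin k) f)
                           (sumL-cong (allFin k) (λ c → reflexive (sumL-map (c ∷_) (words n) f)))

  sumL-words-+ : ∀ a b (f : Word → Carrier) →
                 sumL (words (a +ℕ b)) f ≈ sumL (words a) (λ y → sumL (words b) (λ d → f (y ++ d)))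
  sumL-words-+ zero    b f = sym (+-identityʳ _)
  sumL-words-+ (suc a) b f = begin
    sumL (words (suc a +ℕ b)) f
      ≈⟨ sumL-words-∷ (a +ℕ b) f ⟩
    sumL (allFin k) (λ c → sumL (words (a +ℕ b)) (λ x → f (c ∷ x)))
      ≈⟨ sumL-cong (allFin k) (λ c → sumL-words-+ a b (λ x → f (c ∷ x))) ⟩
    sumL (allFin k) (λ c → sumL (words a) (λ y → sumL (words b) (λ d → f (c ∷ y ++ d))))
      ≈⟨ sumL-words-∷ a _ ⟨
    sumL (words (suc a)) (λ y → sumL (words b) (λ d → f (y ++ d))) ∎

  P-++ : ∀ y d → P (y ++ d) ≈ P y * P d
  P-++ []      d = sym (*-identityˡ _)
  P-++ (a ∷ y) d = trans (*-congˡ (P-++ y d)) (sym (*-assoc _ _ _))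

  sumL-words-P : sumAlphabet ≈ 1# → ∀ n → sumL (words n) P ≈ 1#
  sumL-words-P Σp≈1 zero    = +-identityʳ _
  sumL-words-P Σp≈1 (suc n) = begin
    sumL (words (suc n)) P                                    ≈⟨ sumL-words-∷ n P ⟩
    sumL (allFin k) (λ c → sumL (words n) (λ x → p c * P x))  ≈⟨ sumL-cong (allFin k) (λ c → *-distribˡ-sumL (words n) (p c) P) ⟨
    sumL (allFin k) (λ c → p c * sumL (words n) P)
      ≈⟨ sumL-cong (allFin k) (λ c → trans (*-congˡ (sumL-words-P Σp≈1 n)) (*-identityʳ _)) ⟩
    sumL (allFin k) p                                         ≈⟨ Σp≈1 ⟩
    1#                                                        ∎

  sumL-words-isPrefix : ∀ (u : Word) (g : Word → Carrier) →
                        sumL (words (length u)) (λ d → if isPrefix u d then g d else 0#) ≈ g u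
  sumL-words-isPrefix []      g = +-identityʳ _
  sumL-words-isPrefix (a ∷ u) g = begin
    sumL (words (suc (length u))) h
      ≈⟨ sumL-words-∷ (length u) h ⟩
    sumL (allFin k) (λ c → sumL (words (length u)) (λ d → h (c ∷ d)))
      ≈⟨ sumL-tabulate-single k (λ c → c) _ a other-letter ⟩
    sumL (words (length u)) (λ d → h (a ∷ d))
      ≈⟨ sumL-cong (words (length u)) (λ d → reflexive (same-letter d)) ⟩
    sumL (words (length u)) (λ d → if isPrefix u d then g (a ∷ d) else 0#)
      ≈⟨ sumL-words-isPrefix u (λ d → g (a ∷ d)) ⟩
    g (a ∷ u) ∎
    where
    h : Word → Carrier
    h d = if isPrefix (a ∷ u) d then g d else 0#
    same-letter : ∀ d → h (a ∷ d) ≡ (if isPrefix u d then g (a ∷ d) else 0#)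
    same-letter d with a ≟ a
    ... | yes _  = ≡.refl
    ... | no a≢a = ⊥-elim (a≢a ≡.refl)
    other-letter : ∀ c → c ≢ a → sumL (words (length u)) (λ d → h (c ∷ d)) ≈ 0#
    other-letter c c≢a = sumL-zero (words (length u)) mismatch
      where
      mismatch : ∀ d → h (c ∷ d) ≈ 0#
      mismatch d with a ≟ c
      ... | yes a≡c = ⊥-elim (c≢a (≡.sym a≡c))
      ... | no _    = refl

  𝔼 : (Word → Carrier) → ℕ → Carrier
  𝔼 f n = sumL (words n) (λ x → P x * f x)

  𝔼-cong : ∀ n {f g} → (∀ x → length x ≡ n → f x ≈ g x) → 𝔼 f n ≈ 𝔼 g n
  𝔼-cong n f≈g = sumL-cong-All (words-length n) (λ x |x|≡n → *-congˡ (f≈g x |x|≡n))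

  𝔼-distrib-+ : ∀ n f g → 𝔼 (λ x → f x + g x) n ≈ 𝔼 f n + 𝔼 g n
  𝔼-distrib-+ n f g = trans (sumL-cong (words n) (λ x → distribˡ (P x) (f x) (g x))) (sumL-distrib-+ (words n) _ _)

  𝔼[f-g]≈𝔼f-𝔼g : ∀ n f g → 𝔼 (λ x → f x - g x) n ≈ 𝔼 f n - 𝔼 g n
  𝔼[f-g]≈𝔼f-𝔼g n f g = trans (𝔼-distrib-+ n f (λ x → - g x)) (+-congˡ (trans
    (sumL-cong (words n) (λ x → sym (-‿distribʳ-* (P x) (g x)))) (sym (-‿distrib-sumL (words n) _))))

  𝔼-zero : ∀ n → 𝔼 (λ x → 0#) n ≈ 0#
  𝔼-zero n = sumL-zero (words n) (λ x → zeroʳ (P x))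

  𝔼-concat : ∀ a b (f g : Word → Carrier) →
             𝔼 f a * 𝔼 g b ≈ 𝔼 (λ x → f (take a x) * g (drop a x)) (a +ℕ b)
  𝔼-concat a b f g = begin
    𝔼 f a * 𝔼 g b
      ≈⟨ *-distribʳ-sumL (words a) _ _ ⟩
    sumL (words a) (λ y → (P y * f y) * 𝔼 g b)
      ≈⟨ sumL-cong (words a) (λ y → *-distribˡ-sumL (words b) _ _) ⟩
    sumL (words a) (λ y → sumL (words b) (λ d → (P y * f y) * (P d * g d)))
      ≈⟨ sumL-cong-All (words-length a) (λ y |y|≡a → sumL-cong (words b) (λ d → factor y d |y|≡a)) ⟩
    sumL (words a) (λ y → sumL (words b) (λ d → P (y ++ d) * (f (take a (y ++ d)) * g (drop a (y ++ d)))))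
      ≈⟨ sumL-words-+ a b _ ⟨
    𝔼 (λ x → f (take a x) * g (drop a x)) (a +ℕ b) ∎
    where
    factor : ∀ y d → length y ≡ a →
             (P y * f y) * (P d * g d) ≈ P (y ++ d) * (f (take a (y ++ d)) * g (drop a (y ++ d)))
    factor y d ≡.refl
      rewrite take-length-++ y d | drop-length-++ y d =
      trans (*-interchange _ _ _ _) (*-congʳ (sym (P-++ y d)))

  𝔼-convolution : ∀ n (f g : Word → Carrier) →
                  Σ< (suc n) (λ a → 𝔼 f a * 𝔼 g (n ∸ a)) ≈ 𝔼 (λ x → Σ< (suc n) (λ a → f (take a x) * g (drop a x))) n
  𝔼-convolution n f g = begin
    Σ< (suc n) (λ a → 𝔼 f a * 𝔼 g (n ∸ a))
      ≈⟨ Σ<-cong-< (suc n) (λ a a≤n → trans (𝔼-concat a (n ∸ a) f g)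
                                            (reflexive (≡.cong (𝔼 _) (m+[n∸m]≡n (≤-pred a≤n))))) ⟩
    Σ< (suc n) (λ a → 𝔼 (λ x → f (take a x) * g (drop a x)) n)
      ≈⟨ sumL-Σ<-comm (words n) (suc n) _ ⟨
    sumL (words n) (λ x → Σ< (suc n) (λ a → P x * (f (take a x) * g (drop a x))))
      ≈⟨ sumL-cong (words n) (λ x → *-distribˡ-Σ< (suc n) (P x) _) ⟨
    𝔼 (λ x → Σ< (suc n) (λ a → f (take a x) * g (drop a x))) n ∎

module Occurrences (k : ℕ) (a₀ : Fin k) (w₀ : List (Fin k)) where
  open import Data.Nat using (ℕ; zero; suc; _∸_; _≡ᵇ_; _≤ᵇ_; _<ᵇ_; _<_; _≤_; z≤n; s≤s)
    renaming (_+_ to _+ℕ_; _≟_ to _ℕ≟_)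
  open import Data.Nat.Properties hiding (_≟_)
  open import Data.Bool using (Bool; true; false; if_then_else_; _∧_; _∨_; not)
  open import Data.Bool.Properties using (∧-zeroʳ)
  open import Data.Fin using (Fin; _≟_)
  open import Data.List using (List; []; _∷_; _++_; length; take; drop; null)
  open import Data.List.Properties using (length-++; length-drop; length-take; drop-drop; take-drop; ++-assoc)
  open import Data.Maybe using (Maybe; just; nothing)
  open import Data.Empty using (⊥-elim)
  open import Data.Sum using (_⊎_; inj₁; inj₂)
  open import Data.Product using (Σ; _×_; _,_; proj₁; proj₂)
  open import Function using (id; _∘_)
  open import Relation.Binary.PropositionalEquality as P using (_≡_; _≢_; refl; sym; trans; cong; subst)
  open import Relation.Binary.Definitions using (tri<; tri≈; tri>)
  open import Relation.Nullary using (yes; no)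

  open Words k

  w : Word
  w = a₀ ∷ w₀

  m : ℕ
  m = length w

  isPrefix⇒length≤ : ∀ (u v : Word) → isPrefix u v ≡ true → length u ≤ length v
  isPrefix⇒length≤ []      v       _      = z≤n
  isPrefix⇒length≤ (a ∷ u) (b ∷ v) prefix with a ≟ b
  ... | yes _ = s≤s (isPrefix⇒length≤ u v prefix)

  isPrefix⇒≡++drop : ∀ (u v : Word) → isPrefix u v ≡ true → v ≡ u ++ drop (length u) v
  isPrefix⇒≡++drop []      v       _      = refl
  isPrefix⇒≡++drop (a ∷ u) (b ∷ v) prefix with a ≟ b
  ... | yes refl = cong (a ∷_) (isPrefix⇒≡++drop u v prefix)

  isPrefix-take : ∀ (u v : Word) L → length u ≤ L → isPrefix u (take L v) ≡ isPrefix u v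
  isPrefix-take []      v       L       _         = refl
  isPrefix-take (a ∷ u) []      (suc L) _         = refl
  isPrefix-take (a ∷ u) (b ∷ v) (suc L) (s≤s u≤L) with a ≟ b
  ... | yes _ = isPrefix-take u v L u≤L
  ... | no  _ = refl

  occ : Word → ℕ → Bool
  occ x i = occursAt w x i

  occ⇒+m≤length : ∀ x i → occ x i ≡ true → i +ℕ m ≤ length x
  occ⇒+m≤length x i occ-i = shift i x (isPrefix⇒length≤ w (drop i x) occ-i)
    where
    shift : ∀ i (x : Word) → m ≤ length (drop i x) → i +ℕ m ≤ length x
    shift zero    x       m≤ = m≤
    shift (suc i) (y ∷ x) m≤ = s≤s (shift i x m≤)
    shift (suc i) []      ()

  occ-take : ∀ x i L → i +ℕ m ≤ L → occ (take L x) i ≡ occ x i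
  occ-take x i L i+m≤L = trans (cong (isPrefix w) window) (isPrefix-take w (drop i x) (L ∸ i) m≤L∸i)
    where
    m≤L∸i : m ≤ L ∸ i
    m≤L∸i = m+n≤o⇒m≤o∸n m (subst (_≤ L) (+-comm i m) i+m≤L)
    window : drop i (take L x) ≡ take (L ∸ i) (drop i x)
    window = trans (cong (λ t → drop i (take t x)) (sym (m+[n∸m]≡n (≤-trans (m≤m+n i m) i+m≤L))))
                   (sym (take-drop (L ∸ i) i x))

  occ-++ʳ : ∀ y z j → occ (y ++ z) (length y +ℕ j) ≡ occ z j
  occ-++ʳ y z j = cong (isPrefix w) (drop-length-+-++ y z j)

  occ-drop : ∀ x a j → occ (drop a x) j ≡ occ x (a +ℕ j)
  occ-drop x a j = cong (isPrefix w) (drop-drop a j x)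

  occ-++ˡ : ∀ y z i → i +ℕ m ≤ length y → occ (y ++ z) i ≡ occ y i
  occ-++ˡ y z i i+m≤|y| = trans (sym (occ-take (y ++ z) i (length y) i+m≤|y|)) (cong (λ t → occ t i) (take-length-++ y z))

  drop-at-occ : ∀ x a → m ≤ a → occ x (a ∸ m) ≡ true → drop (a ∸ m) x ≡ w ++ drop a x
  drop-at-occ x a m≤a occ-a = trans (isPrefix⇒≡++drop w (drop (a ∸ m) x) occ-a)
    (cong (w ++_) (trans (drop-drop (a ∸ m) m x) (cong (λ t → drop t x) (m∸n+n≡m m≤a))))

  occ-w++drop : ∀ x a → m ≤ a → occ x (a ∸ m) ≡ true → ∀ j → occ (w ++ drop a x) j ≡ occ x (a ∸ m +ℕ j)
  occ-w++drop x a m≤a occ-a j = trans (cong (λ t → occ t j) (sym (drop-at-occ x a m≤a occ-a))) (occ-drop x (a ∸ m) j)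

  occ⇒<1+length : ∀ x i → occ x i ≡ true → i < suc (length x)
  occ⇒<1+length x i occ-i = s≤s (≤-trans (m≤m+n i m) (occ⇒+m≤length x i occ-i))

  onlyAt⇒ : ∀ x ok → onlyAt w x ok ≡ true → ∀ i → occ x i ≡ true → ok i ≡ true
  onlyAt⇒ x ok only i occ-i with all≡true⇒ (λ i → not (occ x i) ∨ ok i) id (suc (length x)) only i (occ⇒<1+length x i occ-i)
  ... | ok-i rewrite occ-i = ok-i

  ⇒onlyAt : ∀ x ok → (∀ i → occ x i ≡ true → ok i ≡ true) → onlyAt w x ok ≡ true
  ⇒onlyAt x ok occ⇒ok = ⇒all≡true _ id (suc (length x)) ok-or-absent
    where
    ok-or-absent : ∀ i → i < suc (length x) → not (occ x i) ∨ ok i ≡ true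
    ok-or-absent i _ with occ x i in occ-i
    ... | false = refl
    ... | true  = occ⇒ok i occ-i

  onlyAt≡false⇒ : ∀ x ok → onlyAt w x ok ≡ false → Σ ℕ (λ i → occ x i ≡ true × ok i ≡ false)
  onlyAt≡false⇒ x ok not-only with all≡false⇒ (λ i → not (occ x i) ∨ ok i) id (suc (length x)) not-only
  ... | i , _ , bad with occ x i in occ-i
  ...   | true = i , occ-i , bad

  inN⇒¬occ : ∀ x → inN w x ≡ true → ∀ i → occ x i ≡ false
  inN⇒¬occ x x∈N i with occ x i in occ-i
  ... | false = refl
  ... | true with all≡true⇒ (λ i → not (occ x i)) id (suc (length x)) x∈N i (occ⇒<1+length x i occ-i)
  ...   | absent rewrite occ-i = ⊥-elim (false≢true absent)

  ¬occ⇒inN : ∀ x → (∀ i → occ x i ≡ false) → inN w x ≡ true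
  ¬occ⇒inN x absent = ⇒all≡true _ id (suc (length x)) (λ i _ → cong not (absent i))

  endsWith≡occ : ∀ x → endsWith w x ≡ occ x (length x ∸ m)
  endsWith≡occ x with m ≤ᵇ length x in m≤|x|
  ... | true  = refl
  ... | false with occ x (length x ∸ m) in occ-end
  ...   | false = refl
  ...   | true with ≤⇒≤ᵇ≡true m (length x) (≤-trans (m≤n+m m (length x ∸ m)) (occ⇒+m≤length x (length x ∸ m) occ-end))
  ...     | m≤ᵇ|x| rewrite m≤|x| = ⊥-elim (false≢true m≤ᵇ|x|)

  length-take-≤ : ∀ a (x : Word) → a ≤ length x → length (take a x) ≡ a
  length-take-≤ a x a≤|x| = trans (length-take a x) (m≤n⇒m⊓n≡m a≤|x|)

  endsWith-take : ∀ x a → a ≤ length x → m ≤ a → endsWith w (take a x) ≡ occ x (a ∸ m)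
  endsWith-take x a a≤|x| m≤a = trans (endsWith≡occ (take a x))
    (trans (cong (λ t → occ (take a x) (t ∸ m)) (length-take-≤ a x a≤|x|)) (occ-take x (a ∸ m) a (≤-reflexive (m∸n+n≡m m≤a))))

  endsWith-short : ∀ y → length y < m → endsWith w y ≡ false
  endsWith-short y |y|<m with endsWith w y in ends
  ... | false = refl
  ... | true  = ⊥-elim (<⇒≱ |y|<m (≤-trans (m≤n+m m (length y ∸ m))
                  (occ⇒+m≤length y (length y ∸ m) (trans (sym (endsWith≡occ y)) ends))))

  endsWith-take⇒ : ∀ x a → a ≤ length x → endsWith w (take a x) ≡ true → m ≤ a × occ x (a ∸ m) ≡ true
  endsWith-take⇒ x a a≤|x| ends with m ≤? a
  ... | yes m≤a = m≤a , trans (sym (endsWith-take x a a≤|x| m≤a)) ends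
  ... | no  m≰a = ⊥-elim (false≢true (trans (sym (endsWith-short (take a x)
                    (subst (_< m) (sym (length-take-≤ a x a≤|x|)) (≰⇒> m≰a)))) ends))

  endsWith-w++ : ∀ d → endsWith w (w ++ d) ≡ occ (w ++ d) (length d)
  endsWith-w++ d = trans (endsWith≡occ (w ++ d)) (cong (occ (w ++ d)) (trans (cong (_∸ m) (length-++ w)) (m+n∸m≡n m (length d))))

  inU⇒ : ∀ d → inU w d ≡ true → ∀ j → occ (w ++ d) j ≡ true → j ≡ 0
  inU⇒ d d∈U j occ-j = ≡ᵇ≡true⇒≡ j 0 (onlyAt⇒ (w ++ d) (λ i → i ≡ᵇ 0) d∈U j occ-j)

  ⇒inU : ∀ d → (∀ j → occ (w ++ d) j ≡ true → j ≡ 0) → inU w d ≡ true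
  ⇒inU d only = ⇒onlyAt (w ++ d) _ (λ j occ-j → subst (λ t → (t ≡ᵇ 0) ≡ true) (sym (only j occ-j)) refl)

  inU≡false⇒ : ∀ d → inU w d ≡ false → Σ ℕ (λ j → occ (w ++ d) j ≡ true × j ≢ 0)
  inU≡false⇒ d d∉U with onlyAt≡false⇒ (w ++ d) _ d∉U
  ... | j , occ-j , j≢ᵇ0 = j , occ-j , λ j≡0 → false≢true (trans (sym j≢ᵇ0) (subst (λ t → (t ≡ᵇ 0) ≡ true) (sym j≡0) refl))

  ¬null⇒1≤length : ∀ (d : Word) → not (null d) ≡ true → 1 ≤ length d
  ¬null⇒1≤length (_ ∷ d) _ = s≤s z≤n

  inM⇒ : ∀ d → inM w d ≡ true →
         1 ≤ length d × occ (w ++ d) (length d) ≡ true × (∀ j → occ (w ++ d) j ≡ true → j ≡ 0 ⊎ j ≡ length d)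
  inM⇒ d d∈M = ¬null⇒1≤length d (∧≡true⇒ˡ d∈M)
             , trans (sym (endsWith-w++ d)) (∧≡true⇒ˡ (∧≡true⇒ʳ {not (null d)} d∈M))
             , λ j occ-j → ends-only j (onlyAt⇒ (w ++ d) _ (∧≡true⇒ʳ {endsWith w (w ++ d)} (∧≡true⇒ʳ {not (null d)} d∈M)) j occ-j)
    where
    ends-only : ∀ j → ((j ≡ᵇ 0) ∨ (j ≡ᵇ length d)) ≡ true → j ≡ 0 ⊎ j ≡ length d
    ends-only j either with j ≡ᵇ 0 in j≡ᵇ0
    ... | true  = inj₁ (≡ᵇ≡true⇒≡ j 0 j≡ᵇ0)
    ... | false = inj₂ (≡ᵇ≡true⇒≡ j (length d) either)

  ⇒inM : ∀ d → 1 ≤ length d → occ (w ++ d) (length d) ≡ true →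
         (∀ j → occ (w ++ d) j ≡ true → j ≡ 0 ⊎ j ≡ length d) → inM w d ≡ true
  ⇒inM (x ∷ d) _ final only rewrite endsWith-w++ (x ∷ d) | final = ⇒onlyAt (w ++ x ∷ d) _ ends-only
    where
    ends-only : ∀ j → occ (w ++ x ∷ d) j ≡ true → ((j ≡ᵇ 0) ∨ (j ≡ᵇ length (x ∷ d))) ≡ true
    ends-only j occ-j with only j occ-j
    ... | inj₁ refl = refl
    ... | inj₂ refl = ≡ᵇ-refl (length d)

  inC∘⇒ : ∀ e → inC∘ w e ≡ true → 1 ≤ length e × length e < m × occ (w ++ e) (length e) ≡ true
  inC∘⇒ e e∈C∘ = ¬null⇒1≤length e (∧≡true⇒ˡ e∈C∘)
              , <ᵇ≡true⇒< _ _ (∧≡true⇒ˡ (∧≡true⇒ʳ {not (null e)} e∈C∘))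
              , trans (sym (endsWith-w++ e)) (∧≡true⇒ʳ {length e <ᵇ m} (∧≡true⇒ʳ {not (null e)} e∈C∘))

  ⇒inC∘ : ∀ e → 1 ≤ length e → length e < m → occ (w ++ e) (length e) ≡ true → inC∘ w e ≡ true
  ⇒inC∘ (x ∷ e) _ |e|<m final rewrite <⇒<ᵇ≡true _ _ |e|<m | endsWith-w++ (x ∷ e) = final

  occ-w++take : ∀ e j → occ (w ++ take j e) j ≡ occ (w ++ e) j
  occ-w++take e j = trans (cong (λ t → occ t j) (++-take w e j)) (occ-take (w ++ e) j (m +ℕ j) (≤-reflexive (+-comm j m)))
    where
    ++-take : ∀ (u e : Word) j → u ++ take j e ≡ take (length u +ℕ j) (u ++ e)
    ++-take []      e j = refl
    ++-take (a ∷ u) e j = cong (a ∷_) (++-take u e j)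

  inC∘-take⇒ : ∀ e j → j ≤ length e → inC∘ w (take j e) ≡ true → 1 ≤ j × j < m × occ (w ++ e) j ≡ true
  inC∘-take⇒ e j j≤|e| prefix∈C∘ with inC∘⇒ (take j e) prefix∈C∘
  ... | 1≤j , j<m , final rewrite length-take-≤ j e j≤|e| = 1≤j , j<m , trans (sym (occ-w++take e j)) final

  ⇒inC∘-take : ∀ e j → j ≤ length e → 1 ≤ j → j < m → occ (w ++ e) j ≡ true → inC∘ w (take j e) ≡ true
  ⇒inC∘-take e j j≤|e| 1≤j j<m occ-j = ⇒inC∘ (take j e) (subst (1 ≤_) (sym |take|) 1≤j) (subst (_< m) (sym |take|) j<m)
    (subst (λ t → occ (w ++ take j e) t ≡ true) (sym |take|) (trans (occ-w++take e j) occ-j))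
    where
    |take| : length (take j e) ≡ j
    |take| = length-take-≤ j e j≤|e|

  inK⇒ : ∀ e → inK w e ≡ true → inC∘ w e ≡ true × (∀ j → j < length e → inC∘ w (take j e) ≡ false)
  inK⇒ e e∈K = ∧≡true⇒ˡ e∈K , λ j j<|e| →
    not≡true⇒≡false (all≡true⇒ (λ j → not (inC∘ w (take j e))) id (length e) (∧≡true⇒ʳ {inC∘ w e} e∈K) j j<|e|)

  ⇒inK : ∀ e → inC∘ w e ≡ true → (∀ j → j < length e → inC∘ w (take j e) ≡ false) → inK w e ≡ true
  ⇒inK e e∈C∘ no-prefix rewrite e∈C∘ = ⇒all≡true _ id (length e) (λ j j<|e| → cong not (no-prefix j j<|e|))

  inK⇒inM : ∀ e → inK w e ≡ true → inM w e ≡ true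
  inK⇒inM e e∈K with inK⇒ e e∈K
  ... | e∈C∘ , no-prefix with inC∘⇒ e e∈C∘
  ...   | 1≤|e| , |e|<m , final = ⇒inM e 1≤|e| final ends-only
    where
    ends-only : ∀ j → occ (w ++ e) j ≡ true → j ≡ 0 ⊎ j ≡ length e
    ends-only j occ-j with j ℕ≟ 0 | j ℕ≟ length e
    ... | yes j≡0 | _        = inj₁ j≡0
    ... | no _    | yes j≡|e| = inj₂ j≡|e|
    ... | no j≢0  | no j≢|e| = ⊥-elim (false≢true (trans (sym (no-prefix j j<|e|))
                                 (⇒inC∘-take e j (<⇒≤ j<|e|) (n≢0⇒n>0 j≢0) (<-trans j<|e| |e|<m) occ-j)))
      where
      j≤|e| : j ≤ length e
      j≤|e| = +-cancelˡ-≤ m j (length e) (subst (_≤ m +ℕ length e) (+-comm j m)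
                (subst (j +ℕ m ≤_) (length-++ w) (occ⇒+m≤length (w ++ e) j occ-j)))
      j<|e| : j < length e
      j<|e| = ≤∧≢⇒< j≤|e| j≢|e|

  inM⇒inK≡<m : ∀ d → inM w d ≡ true → inK w d ≡ (length d <ᵇ m)
  inM⇒inK≡<m d d∈M with inM⇒ d d∈M
  ... | 1≤|d| , final , ends-only with length d <? m
  ...   | yes |d|<m = trans (⇒inK d (⇒inC∘ d 1≤|d| |d|<m final) no-prefix) (sym (<⇒<ᵇ≡true _ _ |d|<m))
    where
    no-prefix : ∀ j → j < length d → inC∘ w (take j d) ≡ false
    no-prefix j j<|d| with inC∘ w (take j d) in prefix∈C∘
    ... | false = refl
    ... | true with inC∘-take⇒ d j (<⇒≤ j<|d|) prefix∈C∘
    ...   | 1≤j , _ , occ-j with ends-only j occ-j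
    ...     | inj₁ refl = ⊥-elim (<⇒≱ 1≤j z≤n)
    ...     | inj₂ refl = ⊥-elim (<-irrefl refl j<|d|)
  ...   | no |d|≮m with inK w d in d∈K
  ...     | false = sym (≥⇒<ᵇ≡false _ _ (≮⇒≥ |d|≮m))
  ...     | true  = ⊥-elim (|d|≮m (proj₁ (proj₂ (inC∘⇒ d (proj₁ (inK⇒ d d∈K))))))

  cs : Word → ℕ → Bool
  cs x i = clumpStart w x i

  cs⇒occ : ∀ x i → cs x i ≡ true → occ x i ≡ true
  cs⇒occ x i start = ∧≡true⇒ˡ start

  cs⇒disjoint : ∀ x i → cs x i ≡ true → ∀ j → j < i → occ x j ≡ true → j +ℕ m ≤ i
  cs⇒disjoint x i start j j<i occ-j
    with any≡false⇒ (λ j → occ x j ∧ (i <ᵇ j +ℕ m)) id i (not≡true⇒≡false (∧≡true⇒ʳ {occ x i} start)) j j<i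
  ... | no-overlap rewrite occ-j with i <ᵇ j +ℕ m in i<ᵇj+m
  ...   | false = ≮⇒≥ (λ i<j+m → false≢true (trans (sym i<ᵇj+m) (<⇒<ᵇ≡true _ _ i<j+m)))

  ⇒cs : ∀ x i → occ x i ≡ true → (∀ j → j < i → occ x j ≡ true → j +ℕ m ≤ i) → cs x i ≡ true
  ⇒cs x i occ-i disjoint = P.cong₂ (λ a b → a ∧ not b) occ-i (⇒any≡false (λ j → occ x j ∧ (i <ᵇ j +ℕ m)) id i no-overlap)
    where
    no-overlap : ∀ j → j < i → (occ x j ∧ (i <ᵇ j +ℕ m)) ≡ false
    no-overlap j j<i with occ x j in occ-j
    ... | false = refl
    ... | true  = ≥⇒<ᵇ≡false _ _ (disjoint j j<i occ-j)

  cs-local : ∀ x y i → (∀ j → j ≤ i → occ x j ≡ occ y j) → cs x i ≡ cs y i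
  cs-local x y i same = P.cong₂ (λ a b → a ∧ not b) (same i ≤-refl)
    (any-cong (λ j → occ x j ∧ (i <ᵇ j +ℕ m)) (λ j → occ y j ∧ (i <ᵇ j +ℕ m)) id i
              (λ j j<i → cong (_∧ (i <ᵇ j +ℕ m)) (same j (<⇒≤ j<i))))

  clumps≡count : ∀ x → clumps w x ≡ count (cs x) (suc (length x))
  clumps≡count x = length-filter≡count (cs x) id (suc (length x))

  clumps≡count-upTo : ∀ x q → q ≤ length x → (∀ j → occ x j ≡ true → j ≤ q) → clumps w x ≡ count (cs x) (suc q)
  clumps≡count-upTo x q q≤|x| occ⇒≤q = trans (clumps≡count x) (count-tail (cs x) (suc q) (suc (length x)) (s≤s q≤|x|) no-start)
    where
    no-start : ∀ i → suc q ≤ i → i < suc (length x) → cs x i ≡ false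
    no-start i q<i _ with cs x i in start
    ... | false = refl
    ... | true  = ⊥-elim (<⇒≱ q<i (occ⇒≤q i (cs⇒occ x i start)))

  clumps-take≡count : ∀ x q → q +ℕ m ≤ length x → clumps w (take (q +ℕ m) x) ≡ count (cs x) (suc q)
  clumps-take≡count x q q+m≤|x| = trans
    (clumps≡count-upTo (take (q +ℕ m) x) q (subst (q ≤_) (sym (length-take-≤ _ x q+m≤|x|)) (m≤m+n q m)) occ⇒≤q)
    (count-cong _ _ (suc q) (λ i i≤q → cs-local (take (q +ℕ m) x) x i
      (λ j j≤i → occ-take x j (q +ℕ m) (+-monoˡ-≤ m (≤-trans j≤i (≤-pred i≤q))))))
    where
    occ⇒≤q : ∀ j → occ (take (q +ℕ m) x) j ≡ true → j ≤ q
    occ⇒≤q j occ-j = +-cancelʳ-≤ m j q (subst (j +ℕ m ≤_) (length-take-≤ _ x q+m≤|x|) (occ⇒+m≤length (take (q +ℕ m) x) j occ-j))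

  lastOccBelow : Word → ℕ → Maybe ℕ
  lastOccBelow x zero    = nothing
  lastOccBelow x (suc b) = if occ x b then just b else lastOccBelow x b

  lastOccBelow-nothing : ∀ x b → lastOccBelow x b ≡ nothing → ∀ j → j < b → occ x j ≡ false
  lastOccBelow-nothing x (suc b) none j j≤b with occ x b in occ-b
  ... | false with m≤n⇒m<n∨m≡n (≤-pred j≤b)
  ...   | inj₁ j<b  = lastOccBelow-nothing x b none j j<b
  ...   | inj₂ refl = occ-b

  lastOccBelow-just : ∀ x b p → lastOccBelow x b ≡ just p →
                      p < b × occ x p ≡ true × (∀ j → p < j → j < b → occ x j ≡ false)
  lastOccBelow-just x (suc b) p last with occ x b in occ-b
  lastOccBelow-just x (suc b) .b refl | true = n<1+n b , occ-b , λ j b<j j≤b → ⊥-elim (<⇒≱ b<j (≤-pred j≤b))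
  ... | false with lastOccBelow-just x b p last
  ...   | p<b , occ-p , between = <-trans p<b (n<1+n b) , occ-p , between′
    where
    between′ : ∀ j → p < j → j < suc b → occ x j ≡ false
    between′ j p<j j≤b with m≤n⇒m<n∨m≡n (≤-pred j≤b)
    ... | inj₁ j<b  = between j p<j j<b
    ... | inj₂ refl = occ-b

  occ-beyond : ∀ x j → length x < j → occ x j ≡ false
  occ-beyond x j |x|<j with occ x j in occ-j
  ... | false = refl
  ... | true  = ⊥-elim (<⇒≱ |x|<j (≤-trans (m≤m+n j m) (occ⇒+m≤length x j occ-j)))

  data LastOccurrence (x : Word) : Set where
    no-occurrence : inN w x ≡ true → (∀ a → a ≤ length x → endsWith w (take a x) ≡ false) → LastOccurrence x
    last-occurrence : (a₁ : ℕ) → a₁ ≤ length x → inN w x ≡ false →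
      endsWith w (take a₁ x) ≡ true → inU w (drop a₁ x) ≡ true → clumps w (take a₁ x) ≡ clumps w x →
      (∀ a → a ≤ length x → a ≢ a₁ → endsWith w (take a x) ≡ true → inU w (drop a x) ≡ false) →
      LastOccurrence x

  module NoOccurrence (x : Word) (none : lastOccBelow x (suc (length x)) ≡ nothing) where
    no-occ : ∀ i → occ x i ≡ false
    no-occ i with i <? suc (length x)
    ... | yes i≤|x| = lastOccBelow-nothing x _ none i i≤|x|
    ... | no  i≰|x| = occ-beyond x i (≤-pred (≰⇒> i≰|x|))

    no-ends : ∀ a → a ≤ length x → endsWith w (take a x) ≡ false
    no-ends a a≤|x| with m ≤? a
    ... | yes m≤a = trans (endsWith-take x a a≤|x| m≤a) (no-occ (a ∸ m))
    ... | no  m≰a = endsWith-short (take a x) (subst (_< m) (sym (length-take-≤ a x a≤|x|)) (≰⇒> m≰a))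

  module LastAt (x : Word) (q : ℕ) (occ-q : occ x q ≡ true)
                (after : ∀ j → q < j → j < suc (length x) → occ x j ≡ false) where
    q+m≤|x| : q +ℕ m ≤ length x
    q+m≤|x| = occ⇒+m≤length x q occ-q

    occ-q′ : occ x (q +ℕ m ∸ m) ≡ true
    occ-q′ = subst (λ t → occ x t ≡ true) (sym (m+n∸n≡m q m)) occ-q

    none-after : ∀ j → q < j → occ x j ≡ false
    none-after j q<j with j <? suc (length x)
    ... | yes j≤|x| = after j q<j j≤|x|
    ... | no  j≰|x| = occ-beyond x j (≤-pred (≰⇒> j≰|x|))

    last-not-N : inN w x ≡ false
    last-not-N with inN w x in x∈N
    ... | false = refl
    ... | true  = ⊥-elim (false≢true (trans (sym (inN⇒¬occ x x∈N q)) occ-q))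

    last-ends : endsWith w (take (q +ℕ m) x) ≡ true
    last-ends = trans (endsWith-take x (q +ℕ m) q+m≤|x| (m≤n+m m q)) occ-q′

    last-U : inU w (drop (q +ℕ m) x) ≡ true
    last-U = ⇒inU _ (λ j occ-j → at-0 j (trans (sym (occ-w++drop x (q +ℕ m) (m≤n+m m q) occ-q′ j)) occ-j))
      where
      at-0 : ∀ j → occ x (q +ℕ m ∸ m +ℕ j) ≡ true → j ≡ 0
      at-0 zero    _     = refl
      at-0 (suc j) occ-j = ⊥-elim (false≢true (trans (sym (none-after (q +ℕ suc j) (m<m+n q (s≤s z≤n))))
                                                     (subst (λ t → occ x (t +ℕ suc j) ≡ true) (m+n∸n≡m q m) occ-j)))

    last-clumps : clumps w (take (q +ℕ m) x) ≡ clumps w x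
    last-clumps = trans (clumps-take≡count x q q+m≤|x|) (sym (clumps≡count-upTo x q (≤-trans (m≤m+n q m) q+m≤|x|)
      (λ j occ-j → ≮⇒≥ (λ q<j → false≢true (trans (sym (none-after j q<j)) occ-j)))))

    last-unique : ∀ a → a ≤ length x → a ≢ q +ℕ m → endsWith w (take a x) ≡ true → inU w (drop a x) ≡ false
    last-unique a a≤|x| a≢ ends with endsWith-take⇒ x a a≤|x| ends
    ... | m≤a , occ-a with inU w (drop a x) in d∈U
    ...   | false = refl
    ...   | true with <-cmp (a ∸ m) q
    ...     | tri≈ _ a∸m≡q _ = ⊥-elim (a≢ (trans (sym (m∸n+n≡m m≤a)) (cong (_+ℕ m) a∸m≡q)))
    ...     | tri> _ _ q<a∸m = ⊥-elim (false≢true (trans (sym (none-after (a ∸ m) q<a∸m)) occ-a))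
    ...     | tri< a∸m<q _ _ = ⊥-elim (m<n⇒n≢0 (m<n⇒0<n∸m a∸m<q) (inU⇒ _ d∈U (q ∸ (a ∸ m))
                (trans (occ-w++drop x a m≤a occ-a (q ∸ (a ∸ m))) (subst (λ t → occ x t ≡ true) (sym (m+[n∸m]≡n (<⇒≤ a∸m<q))) occ-q))))

  lastOccurrence : ∀ x → LastOccurrence x
  lastOccurrence x with lastOccBelow x (suc (length x)) in last
  ... | nothing = no-occurrence (¬occ⇒inN x no-occ) no-ends
    where open NoOccurrence x last
  ... | just q with lastOccBelow-just x _ q last
  ...   | _ , occ-q , after =
    last-occurrence (q +ℕ m) q+m≤|x| last-not-N last-ends last-U last-clumps last-unique
    where open LastAt x q occ-q after

  endsNewClump : Word → Bool
  endsNewClump x = cs x (length x ∸ m)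

  data PreviousOccurrence (x : Word) : Set where
    not-ending : endsWith w x ≡ false →
      (∀ a → a ≤ length x → endsWith w (take a x) ≡ true → occ (w ++ drop a x) (length (drop a x)) ≡ false) →
      PreviousOccurrence x
    single-occurrence : endsWith w x ≡ true → inR w x ≡ true → clumps w x ≡ 1 → endsNewClump x ≡ true →
      (∀ a → a ≤ length x → endsWith w (take a x) ≡ true → inM w (drop a x) ≡ false) →
      PreviousOccurrence x
    previous-occurrence : (a₁ : ℕ) → a₁ ≤ length x → endsWith w x ≡ true → inR w x ≡ false →
      endsWith w (take a₁ x) ≡ true → inM w (drop a₁ x) ≡ true →
      (∀ a → a ≤ length x → a ≢ a₁ → endsWith w (take a x) ≡ true → inM w (drop a x) ≡ false) →
      clumps w x ≡ clumps w (take a₁ x) +ℕ bit (endsNewClump x) → inK w (drop a₁ x) ≡ not (endsNewClump x) →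
      PreviousOccurrence x

  not-ending⇒no-final-occ : ∀ x → endsWith w x ≡ false → ∀ a → a ≤ length x → endsWith w (take a x) ≡ true →
                            occ (w ++ drop a x) (length (drop a x)) ≡ false
  not-ending⇒no-final-occ x x-not-ending a a≤|x| ends with endsWith-take⇒ x a a≤|x| ends
  ... | m≤a , occ-a with occ (w ++ drop a x) (length (drop a x)) in final
  ...   | false = refl
  ...   | true  = ⊥-elim (false≢true (trans (sym x-not-ending) (trans (endsWith≡occ x) shifted)))
    where
    shifted : occ x (length x ∸ m) ≡ true
    shifted = subst (λ t → occ x t ≡ true) ([a∸m]+[n∸a]≡n∸m m a (length x) m≤a a≤|x|)
      (trans (sym (occ-w++drop x a m≤a occ-a _)) (subst (λ t → occ (w ++ drop a x) t ≡ true) (length-drop a x) final))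

  module EndingText (x : Word) (x-ends : endsWith w x ≡ true) where
    n ℓ : ℕ
    n = length x
    ℓ = n ∸ m

    final-occ : occ x ℓ ≡ true
    final-occ = trans (sym (endsWith≡occ x)) x-ends

    m≤n : m ≤ n
    m≤n = ≤-trans (m≤n+m m ℓ) (occ⇒+m≤length x ℓ final-occ)

    ℓ+m≡n : ℓ +ℕ m ≡ n
    ℓ+m≡n = m∸n+n≡m m≤n

    occ⇒≤ℓ : ∀ j → occ x j ≡ true → j ≤ ℓ
    occ⇒≤ℓ j occ-j = +-cancelʳ-≤ m j ℓ (subst (j +ℕ m ≤_) (sym ℓ+m≡n) (occ⇒+m≤length x j occ-j))

    M-split⇒earlier-occ : ∀ a → a ≤ n → endsWith w (take a x) ≡ true → inM w (drop a x) ≡ true →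
      m ≤ a × occ x (a ∸ m) ≡ true × a ∸ m < ℓ × (∀ j → occ x (a ∸ m +ℕ j) ≡ true → j ≡ 0 ⊎ j ≡ n ∸ a)
    M-split⇒earlier-occ a a≤n ends d∈M with endsWith-take⇒ x a a≤n ends | inM⇒ (drop a x) d∈M
    ... | m≤a , occ-a | 1≤|d| , _ , only =
      m≤a , occ-a , a∸m<ℓ , λ j occ-j → subst (λ t → j ≡ 0 ⊎ j ≡ t) (length-drop a x) (only j (trans (occ-w++drop x a m≤a occ-a j) occ-j))
      where
      a<n : a < n
      a<n = ≤∧≢⇒< a≤n (λ a≡n → <⇒≱ (subst (1 ≤_) (length-drop a x) 1≤|d|) (≤-reflexive (trans (cong (n ∸_) a≡n) (n∸n≡0 n))))
      a∸m<ℓ : a ∸ m < ℓ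
      a∸m<ℓ = +-cancelʳ-< m (a ∸ m) ℓ (P.subst₂ _<_ (sym (m∸n+n≡m m≤a)) (sym ℓ+m≡n) a<n)

    module Single (no-earlier : ∀ j → j < ℓ → occ x j ≡ false) where
      single-inR : inR w x ≡ true
      single-inR rewrite x-ends = ⇒onlyAt x _ at-ℓ
        where
        at-ℓ : ∀ j → occ x j ≡ true → (j ≡ᵇ ℓ) ≡ true
        at-ℓ j occ-j with m≤n⇒m<n∨m≡n (occ⇒≤ℓ j occ-j)
        ... | inj₁ j<ℓ  = ⊥-elim (false≢true (trans (sym (no-earlier j j<ℓ)) occ-j))
        ... | inj₂ refl = ≡ᵇ-refl j

      single-new : endsNewClump x ≡ true
      single-new = ⇒cs x ℓ final-occ (λ j j<ℓ occ-j → ⊥-elim (false≢true (trans (sym (no-earlier j j<ℓ)) occ-j)))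

      single-clumps : clumps w x ≡ 1
      single-clumps = trans (clumps≡count-upTo x ℓ (m∸n≤m n m) occ⇒≤ℓ)
                            (P.cong₂ _+ℕ_ (count-zero (cs x) ℓ no-start) (cong bit single-new))
        where
        no-start : ∀ i → i < ℓ → cs x i ≡ false
        no-start i i<ℓ with cs x i in start
        ... | false = refl
        ... | true  = ⊥-elim (false≢true (trans (sym (no-earlier i i<ℓ)) (cs⇒occ x i start)))

      single-no-M : ∀ a → a ≤ n → endsWith w (take a x) ≡ true → inM w (drop a x) ≡ false
      single-no-M a a≤n ends with inM w (drop a x) in d∈M
      ... | false = refl
      ... | true with M-split⇒earlier-occ a a≤n ends d∈M
      ...   | _ , occ-a , a∸m<ℓ , _ = ⊥-elim (false≢true (trans (sym (no-earlier (a ∸ m) a∸m<ℓ)) occ-a))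

    module Previous (p : ℕ) (p<ℓ : p < ℓ) (occ-p : occ x p ≡ true)
                    (between : ∀ j → p < j → j < ℓ → occ x j ≡ false) where
      p+m≤n : p +ℕ m ≤ n
      p+m≤n = subst (p +ℕ m ≤_) ℓ+m≡n (+-monoˡ-≤ m (<⇒≤ p<ℓ))

      occ-p′ : occ x (p +ℕ m ∸ m) ≡ true
      occ-p′ = subst (λ t → occ x t ≡ true) (sym (m+n∸n≡m p m)) occ-p

      previous-ends : endsWith w (take (p +ℕ m) x) ≡ true
      previous-ends = trans (endsWith-take x (p +ℕ m) p+m≤n (m≤n+m m p)) occ-p′

      tail-length : length (drop (p +ℕ m) x) ≡ ℓ ∸ p
      tail-length = trans (length-drop (p +ℕ m) x) (trans (cong (_∸ (p +ℕ m)) (sym ℓ+m≡n)) ([ℓ+m]∸[p+m]≡ℓ∸p p ℓ m))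

      p+[ℓ∸p]≡ℓ : p +ℕ (ℓ ∸ p) ≡ ℓ
      p+[ℓ∸p]≡ℓ = m+[n∸m]≡n (<⇒≤ p<ℓ)

      occ-tail : ∀ j → occ (w ++ drop (p +ℕ m) x) j ≡ occ x (p +ℕ j)
      occ-tail j = trans (occ-w++drop x (p +ℕ m) (m≤n+m m p) occ-p′ j) (cong (λ t → occ x (t +ℕ j)) (m+n∸n≡m p m))

      previous-M : inM w (drop (p +ℕ m) x) ≡ true
      previous-M = ⇒inM _ (subst (1 ≤_) (sym tail-length) (m<n⇒0<n∸m p<ℓ)) final
                          (λ j occ-j → only j (trans (sym (occ-tail j)) occ-j))
        where
        final : occ (w ++ drop (p +ℕ m) x) (length (drop (p +ℕ m) x)) ≡ true
        final = trans (occ-tail _) (subst (λ t → occ x (p +ℕ t) ≡ true) (sym tail-length)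
                                          (subst (λ t → occ x t ≡ true) (sym p+[ℓ∸p]≡ℓ) final-occ))
        only : ∀ j → occ x (p +ℕ j) ≡ true → j ≡ 0 ⊎ j ≡ length (drop (p +ℕ m) x)
        only zero    _     = inj₁ refl
        only (suc j) occ-j with <-cmp (p +ℕ suc j) ℓ
        ... | tri< p+j<ℓ _ _ = ⊥-elim (false≢true (trans (sym (between (p +ℕ suc j) (m<m+n p (s≤s z≤n)) p+j<ℓ)) occ-j))
        ... | tri≈ _ p+j≡ℓ _ = inj₂ (trans (+-cancelˡ-≡ p _ _ (trans p+j≡ℓ (sym p+[ℓ∸p]≡ℓ))) (sym tail-length))
        ... | tri> _ _ ℓ<p+j = ⊥-elim (<⇒≱ ℓ<p+j (occ⇒≤ℓ _ occ-j))

      previous-not-R : inR w x ≡ false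
      previous-not-R rewrite x-ends with onlyAt w x (λ i → i ≡ᵇ (length x ∸ length w)) in only
      ... | false = refl
      ... | true  = ⊥-elim (<-irrefl (≡ᵇ≡true⇒≡ p ℓ (onlyAt⇒ x _ only p occ-p)) p<ℓ)

      previous-unique : ∀ a → a ≤ n → a ≢ p +ℕ m → endsWith w (take a x) ≡ true → inM w (drop a x) ≡ false
      previous-unique a a≤n a≢ ends with inM w (drop a x) in d∈M
      ... | false = refl
      ... | true with M-split⇒earlier-occ a a≤n ends d∈M
      ...   | m≤a , occ-a , a∸m<ℓ , only with <-cmp (a ∸ m) p
      ...     | tri≈ _ a∸m≡p _ = ⊥-elim (a≢ (trans (sym (m∸n+n≡m m≤a)) (cong (_+ℕ m) a∸m≡p)))
      ...     | tri> _ _ p<a∸m = ⊥-elim (false≢true (trans (sym (between (a ∸ m) p<a∸m a∸m<ℓ)) occ-a))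
      ...     | tri< a∸m<p _ _ with only (p ∸ (a ∸ m)) (subst (λ t → occ x t ≡ true) (sym (m+[n∸m]≡n (<⇒≤ a∸m<p))) occ-p)
      ...       | inj₁ p∸[a∸m]≡0 = ⊥-elim (m<n⇒n≢0 (m<n⇒0<n∸m a∸m<p) p∸[a∸m]≡0)
      ...       | inj₂ p∸[a∸m]≡n∸a = ⊥-elim (<-irrefl p≡ℓ p<ℓ)
        where
        open P.≡-Reasoning
        p≡ℓ : p ≡ ℓ
        p≡ℓ = begin
          p                        ≡⟨ sym (m+[n∸m]≡n (<⇒≤ a∸m<p)) ⟩
          (a ∸ m) +ℕ (p ∸ (a ∸ m)) ≡⟨ cong ((a ∸ m) +ℕ_) p∸[a∸m]≡n∸a ⟩
          (a ∸ m) +ℕ (n ∸ a)       ≡⟨ [a∸m]+[n∸a]≡n∸m m a n m≤a a≤n ⟩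
          ℓ                        ∎

      previous-clumps : clumps w x ≡ clumps w (take (p +ℕ m) x) +ℕ bit (endsNewClump x)
      previous-clumps = trans (clumps≡count-upTo x ℓ (m∸n≤m n m) occ⇒≤ℓ)
        (cong (_+ℕ bit (endsNewClump x)) (trans no-start-between (sym (clumps-take≡count x p p+m≤n))))
        where
        no-start-between : count (cs x) ℓ ≡ count (cs x) (suc p)
        no-start-between = count-tail (cs x) (suc p) ℓ p<ℓ no-start
          where
          no-start : ∀ i → suc p ≤ i → i < ℓ → cs x i ≡ false
          no-start i p<i i<ℓ with cs x i in start
          ... | false = refl
          ... | true  = ⊥-elim (false≢true (trans (sym (between i p<i i<ℓ)) (cs⇒occ x i start)))

      previous-K : inK w (drop (p +ℕ m) x) ≡ not (endsNewClump x)
      previous-K = trans (inM⇒inK≡<m (drop (p +ℕ m) x) previous-M) (trans (cong (_<ᵇ m) tail-length) short⇔overlap)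
        where
        short⇔overlap : (ℓ ∸ p <ᵇ m) ≡ not (endsNewClump x)
        short⇔overlap with p +ℕ m ≤? ℓ
        ... | yes p+m≤ℓ = trans (≥⇒<ᵇ≡false (ℓ ∸ p) m (m+n≤o⇒m≤o∸n m (subst (_≤ ℓ) (+-comm p m) p+m≤ℓ))) (cong not (sym new))
          where
          new : endsNewClump x ≡ true
          new = ⇒cs x ℓ final-occ (λ j j<ℓ occ-j →
            ≤-trans (+-monoˡ-≤ m (≮⇒≥ (λ p<j → false≢true (trans (sym (between j p<j j<ℓ)) occ-j)))) p+m≤ℓ)
        ... | no p+m≰ℓ = trans (<⇒<ᵇ≡true (ℓ ∸ p) m short) (cong not (sym not-new))
          where
          short : ℓ ∸ p < m
          short = +-cancelˡ-< p (ℓ ∸ p) m (subst (_< p +ℕ m) (sym p+[ℓ∸p]≡ℓ) (≰⇒> p+m≰ℓ))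
          not-new : endsNewClump x ≡ false
          not-new with endsNewClump x in new
          ... | false = refl
          ... | true  = ⊥-elim (p+m≰ℓ (cs⇒disjoint x ℓ new p p<ℓ occ-p))

  previousOccurrence : ∀ x → PreviousOccurrence x
  previousOccurrence x with endsWith w x in x-ends
  ... | false = not-ending x-ends (not-ending⇒no-final-occ x x-ends)
  ... | true with lastOccBelow x (length x ∸ m) in last
  ...   | nothing = single-occurrence x-ends single-inR single-clumps single-new single-no-M
    where open EndingText x x-ends
          open Single (lastOccBelow-nothing x ℓ last)
  ...   | just p with lastOccBelow-just x (length x ∸ m) p last
  ...     | p<ℓ , occ-p , between =
    previous-occurrence (p +ℕ m) p+m≤n x-ends previous-not-R previous-ends previous-M previous-unique previous-clumps previous-K
    where open EndingText x x-ends
          open Previous p p<ℓ occ-p between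

  endsWithNewClump : Word → Bool
  endsWithNewClump y = endsWith w y ∧ endsNewClump y

  endsWithNewClump-short : ∀ x a → a ≤ length x → a < m → endsWithNewClump (take a x) ≡ false
  endsWithNewClump-short x a a≤|x| a<m =
    cong (_∧ endsNewClump (take a x)) (endsWith-short (take a x) (subst (_< m) (sym (length-take-≤ a x a≤|x|)) a<m))

  endsWithNewClump-take : ∀ x i → m +ℕ i ≤ length x → endsWithNewClump (take (m +ℕ i) x) ≡ cs x i
  endsWithNewClump-take x i m+i≤|x| = trans (P.cong₂ _∧_ ends new) occ∧cs≡cs
    where
    m+i∸m≡i : m +ℕ i ∸ m ≡ i
    m+i∸m≡i = m+n∸m≡n m i
    ends : endsWith w (take (m +ℕ i) x) ≡ occ x i
    ends = trans (endsWith-take x (m +ℕ i) m+i≤|x| (m≤m+n m i)) (cong (occ x) m+i∸m≡i)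
    new : endsNewClump (take (m +ℕ i) x) ≡ cs x i
    new rewrite length-take-≤ (m +ℕ i) x m+i≤|x| | m+i∸m≡i =
      cs-local _ x i (λ j j≤i → occ-take x j (m +ℕ i) (subst (j +ℕ m ≤_) (+-comm i m) (+-monoˡ-≤ m j≤i)))
    occ∧cs≡cs : (occ x i ∧ cs x i) ≡ cs x i
    occ∧cs≡cs with cs x i in start
    ... | false = ∧-zeroʳ (occ x i)
    ... | true rewrite cs⇒occ x i start = refl

  clumps≡count-endsWithNewClump : ∀ x → clumps w x ≡ count (λ a → endsWithNewClump (take a x)) (suc (length x))
  clumps≡count-endsWithNewClump x with m ≤? length x
  ... | yes m≤n = begin
    clumps w x
      ≡⟨ clumps≡count-upTo x ℓ (m∸n≤m n m) occ⇒≤ℓ ⟩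
    count (cs x) (suc ℓ)
      ≡⟨ count-cong _ _ (suc ℓ) (λ i i≤ℓ → sym (endsWithNewClump-take x i (m+i≤n i (≤-pred i≤ℓ)))) ⟩
    count (λ i → f (m +ℕ i)) (suc ℓ)
      ≡⟨ cong (_+ℕ count (λ i → f (m +ℕ i)) (suc ℓ))
              (count-zero f m (λ a a<m → endsWithNewClump-short x a (≤-trans (<⇒≤ a<m) m≤n) a<m)) ⟨
    count f m +ℕ count (λ i → f (m +ℕ i)) (suc ℓ)
      ≡⟨ count-split f m (suc ℓ) ⟨
    count f (m +ℕ suc ℓ)
      ≡⟨ cong (count f) (trans (+-suc m ℓ) (cong suc (m+[n∸m]≡n m≤n))) ⟩
    count f (suc n) ∎
    where
    open P.≡-Reasoning
    n ℓ : ℕ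
    n = length x
    ℓ = n ∸ m
    f : ℕ → Bool
    f a = endsWithNewClump (take a x)
    occ⇒≤ℓ : ∀ j → occ x j ≡ true → j ≤ ℓ
    occ⇒≤ℓ j occ-j = +-cancelʳ-≤ m j ℓ (subst (j +ℕ m ≤_) (sym (m∸n+n≡m m≤n)) (occ⇒+m≤length x j occ-j))
    m+i≤n : ∀ i → i ≤ ℓ → m +ℕ i ≤ n
    m+i≤n i i≤ℓ = subst (m +ℕ i ≤_) (m+[n∸m]≡n m≤n) (+-monoʳ-≤ m i≤ℓ)
  ... | no m≰n = trans (clumps≡count x) (trans (count-zero _ (suc (length x)) (λ i _ → no-start i))
      (sym (count-zero _ (suc (length x)) (λ a a≤|x| →
        endsWithNewClump-short x a (≤-pred a≤|x|) (≤-<-trans (≤-pred a≤|x|) (≰⇒> m≰n))))))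
    where
    no-start : ∀ i → cs x i ≡ false
    no-start i with cs x i in start
    ... | false = refl
    ... | true  = ⊥-elim (m≰n (≤-trans (m≤n+m m i) (occ⇒+m≤length x i (cs⇒occ x i start))))

  inU-[] : inU w [] ≡ true
  inU-[] = ⇒inU [] (λ j occ-j → n≤0⇒n≡0 (+-cancelʳ-≤ m j 0
    (subst (j +ℕ m ≤_) (trans (length-++ w) (+-identityʳ m)) (occ⇒+m≤length (w ++ []) j occ-j))))

  data UltimateStep (y x : Word) : Set where
    stays-ultimate     : inU w y ≡ true  → inU w x ≡ true  → inM w x ≡ false → UltimateStep y x
    becomes-minimal    : inU w y ≡ true  → inU w x ≡ false → inM w x ≡ true  → UltimateStep y x
    stays-non-ultimate : inU w y ≡ false → inU w x ≡ false → inM w x ≡ false → UltimateStep y x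

  module AppendLetter (y : Word) (c : Fin k) where
    x : Word
    x = y ++ c ∷ []

    |x|≡1+|y| : length x ≡ suc (length y)
    |x|≡1+|y| = trans (length-++ y) (+-comm (length y) 1)

    occ-w++y⇒≤|y| : ∀ j → occ (w ++ y) j ≡ true → j ≤ length y
    occ-w++y⇒≤|y| j occ-j = +-cancelˡ-≤ m j (length y)
      (subst (_≤ m +ℕ length y) (+-comm j m) (subst (j +ℕ m ≤_) (length-++ w) (occ⇒+m≤length (w ++ y) j occ-j)))

    occ-w++x⇒≤1+|y| : ∀ j → occ (w ++ x) j ≡ true → j ≤ suc (length y)
    occ-w++x⇒≤1+|y| j occ-j = +-cancelˡ-≤ m j (suc (length y)) (subst (_≤ m +ℕ suc (length y)) (+-comm j m)
      (subst (j +ℕ m ≤_) (trans (length-++ w) (cong (m +ℕ_) |x|≡1+|y|)) (occ⇒+m≤length (w ++ x) j occ-j)))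

    occ-w++x≡occ-w++y : ∀ j → j ≤ length y → occ (w ++ x) j ≡ occ (w ++ y) j
    occ-w++x≡occ-w++y j j≤|y| = trans (cong (λ t → occ t j) (sym (++-assoc w y (c ∷ []))))
      (occ-++ˡ (w ++ y) (c ∷ []) j (subst (j +ℕ m ≤_) (sym (length-++ w)) (subst (_≤ m +ℕ length y) (+-comm m j) (+-monoʳ-≤ m j≤|y|))))

    earlier-occ : inU w y ≡ true → ∀ j → occ (w ++ x) j ≡ true → j < suc (length y) → j ≡ 0
    earlier-occ y∈U j occ-j j≤|y| = inU⇒ y y∈U j (trans (sym (occ-w++x≡occ-w++y j (≤-pred j≤|y|))) occ-j)

    non-ultimate-step : inU w y ≡ false → UltimateStep y x
    non-ultimate-step y∉U with inU≡false⇒ y y∉U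
    ... | j , occ-j , j≢0 = stays-non-ultimate y∉U x∉U x∉M
      where
      occ-x : occ (w ++ x) j ≡ true
      occ-x = trans (occ-w++x≡occ-w++y j (occ-w++y⇒≤|y| j occ-j)) occ-j
      x∉U : inU w x ≡ false
      x∉U with inU w x in x∈U
      ... | false = refl
      ... | true  = ⊥-elim (j≢0 (inU⇒ x x∈U j occ-x))
      x∉M : inM w x ≡ false
      x∉M with inM w x in x∈M
      ... | false = refl
      ... | true with proj₂ (proj₂ (inM⇒ x x∈M)) j occ-x
      ...   | inj₁ j≡0   = ⊥-elim (j≢0 j≡0)
      ...   | inj₂ j≡|x| = ⊥-elim (<-irrefl (trans j≡|x| |x|≡1+|y|) (s≤s (occ-w++y⇒≤|y| j occ-j)))

    final-occ-step : inU w y ≡ true → occ (w ++ x) (length x) ≡ true → UltimateStep y x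
    final-occ-step y∈U final = becomes-minimal y∈U x∉U (⇒inM x (subst (1 ≤_) (sym |x|≡1+|y|) (s≤s z≤n)) final only)
      where
      x∉U : inU w x ≡ false
      x∉U with inU w x in x∈U
      ... | false = refl
      ... | true  = ⊥-elim (m<n⇒n≢0 (subst (0 <_) (sym |x|≡1+|y|) (s≤s z≤n)) (inU⇒ x x∈U (length x) final))
      only : ∀ j → occ (w ++ x) j ≡ true → j ≡ 0 ⊎ j ≡ length x
      only j occ-j with m≤n⇒m<n∨m≡n (occ-w++x⇒≤1+|y| j occ-j)
      ... | inj₁ j≤|y|   = inj₁ (earlier-occ y∈U j occ-j j≤|y|)
      ... | inj₂ j≡1+|y| = inj₂ (trans j≡1+|y| (sym |x|≡1+|y|))

    no-final-occ-step : inU w y ≡ true → occ (w ++ x) (length x) ≡ false → UltimateStep y x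
    no-final-occ-step y∈U no-final = stays-ultimate y∈U (⇒inU x only) x∉M
      where
      only : ∀ j → occ (w ++ x) j ≡ true → j ≡ 0
      only j occ-j with m≤n⇒m<n∨m≡n (occ-w++x⇒≤1+|y| j occ-j)
      ... | inj₁ j≤|y|   = earlier-occ y∈U j occ-j j≤|y|
      ... | inj₂ j≡1+|y| = ⊥-elim (false≢true (trans (sym no-final)
                             (subst (λ t → occ (w ++ x) t ≡ true) (trans j≡1+|y| (sym |x|≡1+|y|)) occ-j)))
      x∉M : inM w x ≡ false
      x∉M with inM w x in x∈M
      ... | false = refl
      ... | true  = ⊥-elim (false≢true (trans (sym no-final) (proj₁ (proj₂ (inM⇒ x x∈M)))))

  ultimateStep : ∀ y c → UltimateStep y (y ++ c ∷ [])
  ultimateStep y c with inU w y in y∈U | occ (w ++ y ++ c ∷ []) (length (y ++ c ∷ [])) in final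
  ... | false | _     = non-ultimate-step y∈U      where open AppendLetter y c
  ... | true  | true  = final-occ-step y∈U final    where open AppendLetter y c
  ... | true  | false = no-final-occ-step y∈U final where open AppendLetter y c

  inN⇒clumps≡0 : ∀ x → inN w x ≡ true → clumps w x ≡ 0
  inN⇒clumps≡0 x x∈N = trans (clumps≡count x) (count-zero (cs x) (suc (length x)) (λ i _ → no-start i))
    where
    no-start : ∀ i → cs x i ≡ false
    no-start i with cs x i in e
    ... | false = refl
    ... | true  = ⊥-elim (false≢true (trans (sym (inN⇒¬occ x x∈N i)) (cs⇒occ x i e)))

module ClumpDecompositions {c ℓ} (R : CommutativeRing c ℓ) (k : ℕ) (p : Fin k → CommutativeRing.Carrier R)
                           (a₀ : Fin k) (w₀ : List (Fin k)) where
  open CommutativeRing R hiding (zero)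
  open Series R
  open FiniteSums R
  open RingLemmas R
  open BivariateSeries R
  open Bernoulli R k p
  open WordSums R k p
  open Occurrences k a₀ w₀
  open SetoidReasoning setoid
  open RingProperties ring using (-0#≈0#)

  ⟦_⟧ : Bool → Carrier
  ⟦ b ⟧ = if b then 1# else 0#

  if≈*⟦⟧ : ∀ b y → (if b then y else 0#) ≈ y * ⟦ b ⟧
  if≈*⟦⟧ true  y = sym (*-identityʳ y)
  if≈*⟦⟧ false y = sym (zeroʳ y)

  Pr : (Word → Bool) → ℕ → Carrier
  Pr L n = sumL (words n) (λ x → if L x then P x else 0#)

  Pr≈𝔼 : ∀ L n → Pr L n ≈ 𝔼 (λ x → ⟦ L x ⟧) n
  Pr≈𝔼 L n = sumL-cong (words n) (λ x → if≈*⟦⟧ (L x) (P x))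

  Occurring : BS
  Occurring n i = 𝔼 (λ x → ⟦ not (inN w x) ∧ (clumps w x ≡ᵇ i) ⟧) n

  ending : ℕ → Word → Carrier
  ending i x = ⟦ endsWith w x ∧ (clumps w x ≡ᵇ i) ⟧

  Ending : BS
  Ending n i = 𝔼 (ending i) n

  splitSum : (Word → Carrier) → (Word → Bool) → Word → Carrier
  splitSum g L x = Σ< (suc (length x)) (λ a → g (take a x) * ⟦ L (drop a x) ⟧)

  clumpGF≈N⊕Occurring : clumpGF w ≋ gf (inN w) ⊕ Occurring
  clumpGF≈N⊕Occurring n zero    = trans (sumL-cong (words n) split) (sumL-distrib-+ (words n) _ _)
    where
    split : ∀ x → (if clumps w x ≡ᵇ 0 then P x else 0#) ≈
                  (if inN w x then P x else 0#) + P x * ⟦ not (inN w x) ∧ (clumps w x ≡ᵇ 0) ⟧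
    split x with inN w x in x∈N
    ... | true rewrite inN⇒clumps≡0 x x∈N = sym (trans (+-congˡ (zeroʳ _)) (+-identityʳ _))
    ... | false = trans (if≈*⟦⟧ _ (P x)) (sym (+-identityˡ _))
  clumpGF≈N⊕Occurring n (suc i) = trans (sumL-cong (words n) split) (sym (+-identityˡ _))
    where
    split : ∀ x → (if clumps w x ≡ᵇ suc i then P x else 0#) ≈ P x * ⟦ not (inN w x) ∧ (clumps w x ≡ᵇ suc i) ⟧
    split x with inN w x in x∈N
    ... | true rewrite inN⇒clumps≡0 x x∈N = sym (zeroʳ _)
    ... | false = if≈*⟦⟧ _ (P x)

  𝔼-convolution-splitSum : ∀ n (f : Word → Carrier) L →
                           Σ< (suc n) (λ a → 𝔼 f a * Pr L (n ∸ a)) ≈ 𝔼 (splitSum f L) n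
  𝔼-convolution-splitSum n f L = begin
    Σ< (suc n) (λ a → 𝔼 f a * Pr L (n ∸ a))
      ≈⟨ Σ<-cong (suc n) (λ a → *-congˡ (Pr≈𝔼 L (n ∸ a))) ⟩
    Σ< (suc n) (λ a → 𝔼 f a * 𝔼 (λ x → ⟦ L x ⟧) (n ∸ a))
      ≈⟨ 𝔼-convolution n f (λ x → ⟦ L x ⟧) ⟩
    𝔼 (λ x → Σ< (suc n) (λ a → f (take a x) * ⟦ L (drop a x) ⟧)) n
      ≈⟨ 𝔼-cong n (λ x |x|≡n → reflexive (≡.cong (λ t → Σ< (suc t) _) (≡.sym |x|≡n))) ⟩
    𝔼 (splitSum f L) n ∎

  ⊛gf-coeff : ∀ (F : BS) (f : ℕ → Word → Carrier) L → (∀ a i → F a i ≈ 𝔼 (f i) a) →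
              ∀ n i → (F ⊛ gf L) n i ≈ 𝔼 (splitSum (f i) L) n
  ⊛gf-coeff F f L F≈𝔼 n i = trans (⊛-ofZ-coeff F (Pr L) n i)
    (trans (Σ<-cong (suc n) (λ a → *-congʳ (F≈𝔼 a i))) (𝔼-convolution-splitSum n (f i) L))

  Occurring≈Ending⊛U : Occurring ≋ Ending ⊛ gf (inU w)
  Occurring≈Ending⊛U n i = sym (trans (⊛gf-coeff Ending ending (inU w) (λ _ _ → refl) n i)
                                      (𝔼-cong n (λ x _ → last-split x)))
    where
    last-split : ∀ x → splitSum (ending i) (inU w) x ≈ ⟦ not (inN w x) ∧ (clumps w x ≡ᵇ i) ⟧
    last-split x with lastOccurrence x
    ... | no-occurrence x∈N no-ends rewrite x∈N =
      Σ<-zero (suc (length x)) (λ a a≤|x| → trans (*-congʳ (prefix-not-ending a (≤-pred a≤|x|))) (zeroˡ _))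
      where
      prefix-not-ending : ∀ a → a ≤ length x → ending i (take a x) ≈ 0#
      prefix-not-ending a a≤|x| rewrite no-ends a a≤|x| = refl
    ... | last-occurrence a₁ a₁≤|x| x∉N ends₁ ult₁ clumps₁ unique rewrite x∉N =
      trans (Σ<-single (suc (length x)) a₁ _ (s≤s a₁≤|x|) others)
            (trans (reflexive (≡.cong₂ (λ b t → ⟦ b ∧ (t ≡ᵇ i) ⟧ * ⟦ inU w (drop a₁ x) ⟧) ends₁ clumps₁))
                   (trans (*-congˡ (reflexive (≡.cong ⟦_⟧ ult₁))) (*-identityʳ _)))
      where
      others : ∀ a → a < suc (length x) → a ≢ a₁ → ending i (take a x) * ⟦ inU w (drop a x) ⟧ ≈ 0#
      others a a≤|x| a≢a₁ with endsWith w (take a x) in ends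
      ... | false = zeroˡ _
      ... | true rewrite unique a (≤-pred a≤|x|) a≢a₁ ends = zeroʳ _

  VanishesOffEnding : (Word → Carrier) → Set ℓ
  VanishesOffEnding g = ∀ t → endsWith w t ≡ false → g t ≈ 0#

  ⊆M : (Word → Bool) → Set
  ⊆M L = ∀ d → L d ≡ true → inM w d ≡ true

  splitSum-term-zero : ∀ g L x a → VanishesOffEnding g → ⊆M L →
                       (endsWith w (take a x) ≡ true → inM w (drop a x) ≡ false) →
                       g (take a x) * ⟦ L (drop a x) ⟧ ≈ 0#
  splitSum-term-zero g L x a g-vanishes L⊆M not-M with endsWith w (take a x) in ends
  ... | false = trans (*-congʳ (g-vanishes _ ends)) (zeroˡ _)
  ... | true with L (drop a x) in d∈L
  ...   | false = zeroʳ _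
  ...   | true  = ⊥-elim (false≢true (≡.trans (≡.sym (not-M ≡.refl)) (L⊆M _ d∈L)))

  splitSum-zero : ∀ g L x → VanishesOffEnding g → ⊆M L →
                  (∀ a → a ≤ length x → endsWith w (take a x) ≡ true → inM w (drop a x) ≡ false) →
                  splitSum g L x ≈ 0#
  splitSum-zero g L x g-vanishes L⊆M not-M =
    Σ<-zero (suc (length x)) (λ a a≤|x| → splitSum-term-zero g L x a g-vanishes L⊆M (not-M a (≤-pred a≤|x|)))

  splitSum-single : ∀ g L x a₁ → VanishesOffEnding g → ⊆M L → a₁ ≤ length x →
                    (∀ a → a ≤ length x → a ≢ a₁ → endsWith w (take a x) ≡ true → inM w (drop a x) ≡ false) →
                    splitSum g L x ≈ g (take a₁ x) * ⟦ L (drop a₁ x) ⟧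
  splitSum-single g L x a₁ g-vanishes L⊆M a₁≤|x| not-M =
    Σ<-single (suc (length x)) a₁ _ (s≤s a₁≤|x|)
      (λ a a≤|x| a≢a₁ → splitSum-term-zero g L x a g-vanishes L⊆M (not-M a (≤-pred a≤|x|) a≢a₁))

  M⊆M : ⊆M (inM w)
  M⊆M d d∈M = d∈M

  not-ending⇒no-M-split :
    ∀ x → (∀ a → a ≤ length x → endsWith w (take a x) ≡ true → occ (w ++ drop a x) (length (drop a x)) ≡ false) →
    ∀ a → a ≤ length x → endsWith w (take a x) ≡ true → inM w (drop a x) ≡ false
  not-ending⇒no-M-split x no-final a a≤|x| ends with inM w (drop a x) in d∈M
  ... | false = ≡.refl
  ... | true  = ⊥-elim (false≢true (≡.trans (≡.sym (no-final a a≤|x| ends)) (proj₁ (proj₂ (inM⇒ (drop a x) d∈M)))))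

  ending-vanishes : ∀ i → VanishesOffEnding (ending i)
  ending-vanishes i t t-not-ending rewrite t-not-ending = refl

  ending-0-split : ∀ x → ending 0 x ≈ splitSum (ending 0) (inK w) x
  ending-0-split x with previousOccurrence x
  ... | not-ending x-not-ending no-final rewrite x-not-ending =
    sym (splitSum-zero (ending 0) (inK w) x (ending-vanishes 0) inK⇒inM (not-ending⇒no-M-split x no-final))
  ... | single-occurrence x-ends _ one-clump _ no-M rewrite x-ends | one-clump =
    sym (splitSum-zero (ending 0) (inK w) x (ending-vanishes 0) inK⇒inM no-M)
  ... | previous-occurrence a₁ a₁≤|x| x-ends _ ends₁ _ unique clumps-x K≡¬new rewrite x-ends =
    sym (trans (splitSum-single (ending 0) (inK w) x a₁ (ending-vanishes 0) inK⇒inM a₁≤|x| unique) (by-newness (endsNewClump x) ≡.refl))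
    where
    by-newness : ∀ b → endsNewClump x ≡ b → ending 0 (take a₁ x) * ⟦ inK w (drop a₁ x) ⟧ ≈ ⟦ clumps w x ≡ᵇ 0 ⟧
    by-newness true  new rewrite ends₁ | K≡¬new | clumps-x | new | ℕ.+-comm (clumps w (take a₁ x)) 1 = zeroʳ _
    by-newness false new rewrite ends₁ | K≡¬new | clumps-x | new | ℕ.+-identityʳ (clumps w (take a₁ x)) = *-identityʳ _

  ending-suc-split : ∀ x j → ending (suc j) x ≈
    (⟦ (j ≡ᵇ 0) ∧ inR w x ⟧ + splitSum (ending (suc j)) (inK w) x)
    + (splitSum (ending j) (inM w) x - splitSum (ending j) (inK w) x)
  ending-suc-split x j with previousOccurrence x
  ... | not-ending x-not-ending no-final rewrite x-not-ending | ∧-zeroʳ (j ≡ᵇ 0) = sym (begin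
    (0# + splitSum (ending (suc j)) (inK w) x) + (splitSum (ending j) (inM w) x - splitSum (ending j) (inK w) x)
      ≈⟨ +-cong (trans (+-identityˡ _) (none (suc j) (inK w) inK⇒inM))
                (+-cong (none j (inM w) M⊆M) (-‿cong (none j (inK w) inK⇒inM))) ⟩
    0# + (0# - 0#)
      ≈⟨ trans (+-identityˡ _) (x-x≈0 0#) ⟩
    0# ∎)
    where
    none : ∀ i L → ⊆M L → splitSum (ending i) L x ≈ 0#
    none i L L⊆M = splitSum-zero (ending i) L x (ending-vanishes i) L⊆M (not-ending⇒no-M-split x no-final)
  ... | single-occurrence x-ends x∈R one-clump _ no-M rewrite x-ends | x∈R | one-clump = sym (begin
    (⟦ (j ≡ᵇ 0) ∧ true ⟧ + splitSum (ending (suc j)) (inK w) x) + (splitSum (ending j) (inM w) x - splitSum (ending j) (inK w) x)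
      ≈⟨ +-cong (+-congˡ (none (suc j) (inK w) inK⇒inM))
                (+-cong (none j (inM w) M⊆M) (-‿cong (none j (inK w) inK⇒inM))) ⟩
    (⟦ (j ≡ᵇ 0) ∧ true ⟧ + 0#) + (0# - 0#)
      ≈⟨ +-cong (+-identityʳ _) (x-x≈0 0#) ⟩
    ⟦ (j ≡ᵇ 0) ∧ true ⟧ + 0#
      ≈⟨ +-identityʳ _ ⟩
    ⟦ (j ≡ᵇ 0) ∧ true ⟧
      ≡⟨ ≡.cong ⟦_⟧ (≡.trans (∧-identityʳ (j ≡ᵇ 0)) (≡ᵇ-sym j 0)) ⟩
    ⟦ 1 ≡ᵇ suc j ⟧ ∎)
    where
    none : ∀ i L → ⊆M L → splitSum (ending i) L x ≈ 0#
    none i L L⊆M = splitSum-zero (ending i) L x (ending-vanishes i) L⊆M no-M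
  ... | previous-occurrence a₁ a₁≤|x| x-ends x∉R ends₁ M₁ unique clumps-x K≡¬new rewrite x-ends | x∉R | ∧-zeroʳ (j ≡ᵇ 0) = sym (begin
    (0# + splitSum (ending (suc j)) (inK w) x) + (splitSum (ending j) (inM w) x - splitSum (ending j) (inK w) x)
      ≈⟨ +-cong (trans (+-identityˡ _) (single (suc j) (inK w) inK⇒inM))
                (+-cong (single j (inM w) M⊆M) (-‿cong (single j (inK w) inK⇒inM))) ⟩
    term (suc j) (inK w) + (term j (inM w) - term j (inK w))
      ≈⟨ by-newness (endsNewClump x) ≡.refl ⟩
    ⟦ clumps w x ≡ᵇ suc j ⟧ ∎)
    where
    term : ℕ → (Word → Bool) → Carrier
    term i L = ending i (take a₁ x) * ⟦ L (drop a₁ x) ⟧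
    single : ∀ i L → ⊆M L → splitSum (ending i) L x ≈ term i L
    single i L L⊆M = splitSum-single (ending i) L x a₁ (ending-vanishes i) L⊆M a₁≤|x| unique
    by-newness : ∀ b → endsNewClump x ≡ b → term (suc j) (inK w) + (term j (inM w) - term j (inK w)) ≈ ⟦ clumps w x ≡ᵇ suc j ⟧
    by-newness true  new rewrite ends₁ | K≡¬new | M₁ | clumps-x | new | ℕ.+-comm (clumps w (take a₁ x)) 1 =
      trans (+-cong (zeroʳ _) (trans (+-congˡ (-‿cong (zeroʳ _))) (trans (x-0≈x _) (*-identityʳ _)))) (+-identityˡ _)
    by-newness false new rewrite ends₁ | K≡¬new | M₁ | clumps-x | new | ℕ.+-identityʳ (clumps w (take a₁ x)) =
      trans (+-congˡ (x-x≈0 _)) (trans (+-identityʳ _) (*-identityʳ _))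

  Ending⊛gf-coeff : ∀ L n i → (Ending ⊛ gf L) n i ≈ 𝔼 (splitSum (ending i) L) n
  Ending⊛gf-coeff L = ⊛gf-coeff Ending ending L (λ _ _ → refl)

  𝕦⊛R-coeff : ∀ n j → (𝕦 ⊛ gf (inR w)) n (suc j) ≈ 𝔼 (λ x → ⟦ (j ≡ᵇ 0) ∧ inR w x ⟧) n
  𝕦⊛R-coeff n j = trans (𝕦⊛-coeff-suc (gf (inR w)) n j) (by-cases j)
    where
    by-cases : ∀ j → gf (inR w) n j ≈ 𝔼 (λ x → ⟦ (j ≡ᵇ 0) ∧ inR w x ⟧) n
    by-cases zero    = Pr≈𝔼 (inR w) n
    by-cases (suc j) = sym (𝔼-zero n)

  Ending-equation : Ending ≋ 𝕦 ⊛ gf (inR w) ⊕ Ending ⊛ gf (inK w) ⊕ 𝕦 ⊛ (Ending ⊛ (gf (inM w) ⊖ gf (inK w)))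
  Ending-equation n zero = sym (begin
    ((𝕦 ⊛ gf (inR w)) n 0 + (Ending ⊛ gf (inK w)) n 0) + (𝕦 ⊛ (Ending ⊛ (gf (inM w) ⊖ gf (inK w)))) n 0
      ≈⟨ +-cong (+-cong (𝕦⊛-coeff-0 (gf (inR w)) n) (Ending⊛gf-coeff (inK w) n 0)) (𝕦⊛-coeff-0 (Ending ⊛ (gf (inM w) ⊖ gf (inK w))) n) ⟩
    (0# + 𝔼 (splitSum (ending 0) (inK w)) n) + 0#
      ≈⟨ trans (+-identityʳ _) (+-identityˡ _) ⟩
    𝔼 (splitSum (ending 0) (inK w)) n
      ≈⟨ 𝔼-cong n (λ x _ → ending-0-split x) ⟨
    Ending n 0 ∎)
  Ending-equation n (suc j) = sym (begin
    ((𝕦 ⊛ gf (inR w)) n (suc j) + (Ending ⊛ gf (inK w)) n (suc j)) + (𝕦 ⊛ (Ending ⊛ (gf (inM w) ⊖ gf (inK w)))) n (suc j)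
      ≈⟨ +-cong (+-cong (𝕦⊛R-coeff n j) (Ending⊛gf-coeff (inK w) n (suc j)))
                (trans (𝕦⊛-coeff-suc (Ending ⊛ (gf (inM w) ⊖ gf (inK w))) n j) (trans (⊛-distribˡ-⊖ Ending (gf (inM w)) (gf (inK w)) n j)
                       (+-cong (Ending⊛gf-coeff (inM w) n j) (-‿cong (Ending⊛gf-coeff (inK w) n j))))) ⟩
    (𝔼 (λ x → ⟦ (j ≡ᵇ 0) ∧ inR w x ⟧) n + 𝔼 (splitSum (ending (suc j)) (inK w)) n)
      + (𝔼 (splitSum (ending j) (inM w)) n - 𝔼 (splitSum (ending j) (inK w)) n)
      ≈⟨ +-cong (𝔼-distrib-+ n _ _) (𝔼[f-g]≈𝔼f-𝔼g n _ _) ⟨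
    𝔼 (λ x → ⟦ (j ≡ᵇ 0) ∧ inR w x ⟧ + splitSum (ending (suc j)) (inK w) x) n
      + 𝔼 (λ x → splitSum (ending j) (inM w) x - splitSum (ending j) (inK w) x) n
      ≈⟨ 𝔼-distrib-+ n _ _ ⟨
    𝔼 (λ x → (⟦ (j ≡ᵇ 0) ∧ inR w x ⟧ + splitSum (ending (suc j)) (inK w) x)
             + (splitSum (ending j) (inM w) x - splitSum (ending j) (inK w) x)) n
      ≈⟨ 𝔼-cong n (λ x _ → ending-suc-split x j) ⟨
    Ending n (suc j) ∎)

  gf⊛gf : ∀ L L′ → gf L ⊛ gf L′ ≋ ofZ (𝔼 (splitSum (λ t → ⟦ L t ⟧) L′))
  gf⊛gf L L′ = 𝔹.trans (ofZ-⊛-ofZ (Pr L) (Pr L′))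
    (ofZ-cong (λ n → trans (Σ<-cong (suc n) (λ a → *-congʳ (Pr≈𝔼 L a))) (𝔼-convolution-splitSum n (λ t → ⟦ L t ⟧) L′)))

  ⟦endsWith⟧ : Word → Carrier
  ⟦endsWith⟧ t = ⟦ endsWith w t ⟧

  ⟦endsWith⟧-vanishes : VanishesOffEnding ⟦endsWith⟧
  ⟦endsWith⟧-vanishes t t-not-ending rewrite t-not-ending = refl

  endsWith-split : ∀ x → ⟦ endsWith w x ⟧ ≈ ⟦ inR w x ⟧ + splitSum ⟦endsWith⟧ (inM w) x
  endsWith-split x with previousOccurrence x
  ... | not-ending x-not-ending no-final rewrite x-not-ending =
    sym (trans (+-identityˡ _) (splitSum-zero ⟦endsWith⟧ (inM w) x ⟦endsWith⟧-vanishes M⊆M (not-ending⇒no-M-split x no-final)))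
  ... | single-occurrence x-ends x∈R _ _ no-M rewrite x-ends | x∈R =
    sym (trans (+-congˡ (splitSum-zero ⟦endsWith⟧ (inM w) x ⟦endsWith⟧-vanishes M⊆M no-M)) (+-identityʳ _))
  ... | previous-occurrence a₁ a₁≤|x| x-ends x∉R ends₁ M₁ unique _ _ rewrite x-ends | x∉R =
    sym (trans (+-identityˡ _) (trans (splitSum-single ⟦endsWith⟧ (inM w) x a₁ ⟦endsWith⟧-vanishes M⊆M a₁≤|x| unique)
                                      (trans (reflexive (≡.cong₂ (λ b c → ⟦ b ⟧ * ⟦ c ⟧) ends₁ M₁)) (*-identityʳ _))))

  Ends-equation : gf (endsWith w) ≋ gf (inR w) ⊕ gf (endsWith w) ⊛ gf (inM w)
  Ends-equation = 𝔹.trans (ofZ-cong split)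
    (𝔹.sym (𝔹.trans (𝔹.+-congˡ {gf (inR w)} (gf⊛gf (endsWith w) (inM w))) (ofZ-⊕-ofZ (Pr (inR w)) _)))
    where
    split : ∀ n → Pr (endsWith w) n ≈ Pr (inR w) n + 𝔼 (splitSum ⟦endsWith⟧ (inM w)) n
    split n = begin
      Pr (endsWith w) n                                                   ≈⟨ Pr≈𝔼 (endsWith w) n ⟩
      𝔼 (λ x → ⟦ endsWith w x ⟧) n                                        ≈⟨ 𝔼-cong n (λ x _ → endsWith-split x) ⟩
      𝔼 (λ x → ⟦ inR w x ⟧ + splitSum ⟦endsWith⟧ (inM w) x) n            ≈⟨ 𝔼-distrib-+ n _ _ ⟩
      𝔼 (λ x → ⟦ inR w x ⟧) n + 𝔼 (splitSum ⟦endsWith⟧ (inM w)) n        ≈⟨ +-congʳ (Pr≈𝔼 (inR w) n) ⟨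
      Pr (inR w) n + 𝔼 (splitSum ⟦endsWith⟧ (inM w)) n                   ∎

  endsWithNewClump-split : ∀ x → ⟦ endsWithNewClump x ⟧ ≈
    ⟦ inR w x ⟧ + (splitSum ⟦endsWith⟧ (inM w) x - splitSum ⟦endsWith⟧ (inK w) x)
  endsWithNewClump-split x with previousOccurrence x
  ... | not-ending x-not-ending no-final rewrite x-not-ending =
    sym (trans (+-identityˡ _) (trans (+-cong (none (inM w) M⊆M) (-‿cong (none (inK w) inK⇒inM))) (x-x≈0 0#)))
    where
    none : ∀ L → ⊆M L → splitSum ⟦endsWith⟧ L x ≈ 0#
    none L L⊆M = splitSum-zero ⟦endsWith⟧ L x ⟦endsWith⟧-vanishes L⊆M (not-ending⇒no-M-split x no-final)
  ... | single-occurrence x-ends x∈R _ new no-M rewrite x-ends | x∈R | new =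
    sym (trans (+-congˡ (trans (+-cong (none (inM w) M⊆M) (-‿cong (none (inK w) inK⇒inM))) (x-x≈0 0#))) (+-identityʳ _))
    where
    none : ∀ L → ⊆M L → splitSum ⟦endsWith⟧ L x ≈ 0#
    none L L⊆M = splitSum-zero ⟦endsWith⟧ L x ⟦endsWith⟧-vanishes L⊆M no-M
  ... | previous-occurrence a₁ a₁≤|x| x-ends x∉R ends₁ M₁ unique _ K≡¬new rewrite x-ends | x∉R =
    sym (trans (+-identityˡ _) (trans (+-cong (single (inM w) M⊆M) (-‿cong (single (inK w) inK⇒inM)))
                                      (by-newness (endsNewClump x) ≡.refl)))
    where
    single : ∀ L → ⊆M L → splitSum ⟦endsWith⟧ L x ≈ ⟦endsWith⟧ (take a₁ x) * ⟦ L (drop a₁ x) ⟧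
    single L L⊆M = splitSum-single ⟦endsWith⟧ L x a₁ ⟦endsWith⟧-vanishes L⊆M a₁≤|x| unique
    by-newness : ∀ b → endsNewClump x ≡ b →
                 ⟦endsWith⟧ (take a₁ x) * ⟦ inM w (drop a₁ x) ⟧ - ⟦endsWith⟧ (take a₁ x) * ⟦ inK w (drop a₁ x) ⟧
                 ≈ ⟦ endsNewClump x ⟧
    by-newness true  new rewrite ends₁ | K≡¬new | M₁ | new =
      trans (+-congˡ (-‿cong (zeroʳ _))) (trans (x-0≈x _) (*-identityʳ _))
    by-newness false new rewrite ends₁ | K≡¬new | M₁ | new = x-x≈0 _

  NewClump-equation : gf endsWithNewClump ≋ gf (inR w) ⊕ gf (endsWith w) ⊛ (gf (inM w) ⊖ gf (inK w))
  NewClump-equation = 𝔹.trans (ofZ-cong split) (𝔹.sym (𝔹.trans (𝔹.+-congˡ {gf (inR w)} (𝔹.trans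
      (⊛-distribˡ-⊖ (gf (endsWith w)) (gf (inM w)) (gf (inK w)))
      (𝔹.trans (𝔹.+-cong (gf⊛gf (endsWith w) (inM w)) (𝔹.-‿cong (gf⊛gf (endsWith w) (inK w))))
               (ofZ-⊖-ofZ _ _))))
    (ofZ-⊕-ofZ (Pr (inR w)) _)))
    where
    split : ∀ n → Pr endsWithNewClump n ≈
                  Pr (inR w) n + (𝔼 (splitSum ⟦endsWith⟧ (inM w)) n - 𝔼 (splitSum ⟦endsWith⟧ (inK w)) n)
    split n = begin
      Pr endsWithNewClump n
        ≈⟨ Pr≈𝔼 endsWithNewClump n ⟩
      𝔼 (λ x → ⟦ endsWithNewClump x ⟧) n
        ≈⟨ 𝔼-cong n (λ x _ → endsWithNewClump-split x) ⟩
      𝔼 (λ x → ⟦ inR w x ⟧ + (splitSum ⟦endsWith⟧ (inM w) x - splitSum ⟦endsWith⟧ (inK w) x)) n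
        ≈⟨ trans (𝔼-distrib-+ n _ _) (+-cong (sym (Pr≈𝔼 (inR w) n)) (𝔼[f-g]≈𝔼f-𝔼g n _ _)) ⟩
      Pr (inR w) n + (𝔼 (splitSum ⟦endsWith⟧ (inM w)) n - 𝔼 (splitSum ⟦endsWith⟧ (inK w)) n) ∎

  Pr-endsWith : sumAlphabet ≈ 1# → ∀ n → Pr (endsWith w) n ≈ (if m ≤ᵇ n then P w else 0#)
  Pr-endsWith Σp≈1 n with m ℕ.≤? n
  ... | no m≰n rewrite >⇒≤ᵇ≡false m n (ℕ.≰⇒> m≰n) =
    sumL-zero′ (λ x |x|≡n → reflexive (≡.cong (λ b → if b then P x else 0#)
                                               (endsWith-short x (≡.subst (_< m) (≡.sym |x|≡n) (ℕ.≰⇒> m≰n)))))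
    where
    sumL-zero′ : (∀ x → length x ≡ n → (if endsWith w x then P x else 0#) ≈ 0#) → Pr (endsWith w) n ≈ 0#
    sumL-zero′ short = trans (sumL-cong-All (words-length n) short) (sumL-zero (words n) (λ _ → refl))
  ... | yes m≤n rewrite ≤⇒≤ᵇ≡true m n m≤n = begin
    Pr (endsWith w) n
      ≡⟨ ≡.cong (Pr (endsWith w)) (≡.sym (ℕ.m∸n+n≡m m≤n)) ⟩
    sumL (words (n ∸ m +ℕ m)) f
      ≈⟨ sumL-words-+ (n ∸ m) m f ⟩
    sumL (words (n ∸ m)) (λ y → sumL (words m) (λ d → f (y ++ d)))
      ≈⟨ sumL-cong (words (n ∸ m)) (λ y → sumL-cong-All (words-length m) (λ d |d|≡m → factor y d |d|≡m)) ⟩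
    sumL (words (n ∸ m)) (λ y → sumL (words m) (λ d → P y * (if isPrefix w d then P d else 0#)))
      ≈⟨ sumL-cong (words (n ∸ m)) (λ y → *-distribˡ-sumL (words m) (P y) _) ⟨
    sumL (words (n ∸ m)) (λ y → P y * sumL (words m) (λ d → if isPrefix w d then P d else 0#))
      ≈⟨ sumL-cong (words (n ∸ m)) (λ y → *-congˡ (sumL-words-isPrefix w P)) ⟩
    sumL (words (n ∸ m)) (λ y → P y * P w)
      ≈⟨ *-distribʳ-sumL (words (n ∸ m)) (P w) P ⟨
    sumL (words (n ∸ m)) P * P w
      ≈⟨ *-congʳ (sumL-words-P Σp≈1 (n ∸ m)) ⟩
    1# * P w
      ≈⟨ *-identityˡ _ ⟩
    P w ∎
    where
    f : Word → Carrier
    f x = if endsWith w x then P x else 0#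
    endsWith-++ : ∀ y d → length d ≡ m → endsWith w (y ++ d) ≡ isPrefix w d
    endsWith-++ y d |d|≡m = ≡.trans (endsWith≡occ (y ++ d)) (≡.trans (≡.cong (occ (y ++ d)) suffix-start) (occ-++ʳ y d 0))
      where
      suffix-start : length (y ++ d) ∸ m ≡ length y +ℕ 0
      suffix-start rewrite length-++ y {d} | |d|≡m | ℕ.+-identityʳ (length y) = ℕ.m+n∸n≡m (length y) m
    factor : ∀ y d → length d ≡ m → f (y ++ d) ≈ P y * (if isPrefix w d then P d else 0#)
    factor y d |d|≡m rewrite endsWith-++ y d |d|≡m with isPrefix w d
    ... | true  = P-++ y d
    ... | false = sym (zeroʳ _)

  Ends⊛[𝟙⊖𝕫]≈πz^m : sumAlphabet ≈ 1# → gf (endsWith w) ⊛ (𝟙 ⊖ 𝕫) ≋ mono (P w) m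
  Ends⊛[𝟙⊖𝕫]≈πz^m Σp≈1 = 𝔹.trans (ofZ-⊛[𝟙⊖𝕫] (Pr (endsWith w)))
    (𝔹.trans (ofZ-cong (λ n → trans (Δ-cong (Pr-endsWith Σp≈1) n) (Δ-step (P w) m n))) (𝔹.sym (mono≈ofZ (P w) m)))

  ℕ→R-+ : ∀ a b → ℕ→R (a +ℕ b) ≈ ℕ→R a + ℕ→R b
  ℕ→R-+ zero    b = sym (+-identityˡ _)
  ℕ→R-+ (suc a) b = trans (+-congˡ (ℕ→R-+ a b)) (sym (+-assoc _ _ _))

  ℕ→R-count : ∀ f L → ℕ→R (count f L) ≈ Σ< L (λ a → ⟦ f a ⟧)
  ℕ→R-count f zero    = refl
  ℕ→R-count f (suc L) = trans (ℕ→R-+ (count f L) (bit (f L))) (+-cong (ℕ→R-count f L) (bit≈⟦⟧ (f L)))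
    where
    bit≈⟦⟧ : ∀ b → ℕ→R (bit b) ≈ ⟦ b ⟧
    bit≈⟦⟧ true  = +-identityʳ _
    bit≈⟦⟧ false = refl

  Γ≈Σ<-Pr-endsWithNewClump : sumAlphabet ≈ 1# → ∀ n → Γ w n ≈ Σ< (suc n) (Pr endsWithNewClump)
  Γ≈Σ<-Pr-endsWithNewClump Σp≈1 n = begin
    Γ w n
      ≈⟨ sumL-cong-All (words-length n) count-clumps ⟩
    𝔼 (λ x → Σ< (suc n) (λ a → ⟦ endsWithNewClump (take a x) ⟧ * 1#)) n
      ≈⟨ 𝔼-convolution n (λ t → ⟦ endsWithNewClump t ⟧) (λ _ → 1#) ⟨
    Σ< (suc n) (λ a → 𝔼 (λ t → ⟦ endsWithNewClump t ⟧) a * 𝔼 (λ _ → 1#) (n ∸ a))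
      ≈⟨ Σ<-cong (suc n) (λ a → trans (*-cong (sym (Pr≈𝔼 endsWithNewClump a)) (𝔼-one (n ∸ a))) (*-identityʳ _)) ⟩
    Σ< (suc n) (Pr endsWithNewClump) ∎
    where
    𝔼-one : ∀ n → 𝔼 (λ _ → 1#) n ≈ 1#
    𝔼-one n = trans (sumL-cong (words n) (λ x → *-identityʳ _)) (sumL-words-P Σp≈1 n)
    count-clumps : ∀ x → length x ≡ n →
                   ℕ→R (clumps w x) * P x ≈ P x * Σ< (suc n) (λ a → ⟦ endsWithNewClump (take a x) ⟧ * 1#)
    count-clumps x ≡.refl = trans (*-comm _ _) (*-congˡ (begin
      ℕ→R (clumps w x)
        ≡⟨ ≡.cong ℕ→R (clumps≡count-endsWithNewClump x) ⟩
      ℕ→R (count (λ a → endsWithNewClump (take a x)) (suc (length x)))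
        ≈⟨ ℕ→R-count _ (suc (length x)) ⟩
      Σ< (suc (length x)) (λ a → ⟦ endsWithNewClump (take a x) ⟧)
        ≈⟨ Σ<-cong (suc (length x)) (λ a → *-identityʳ _) ⟨
      Σ< (suc (length x)) (λ a → ⟦ endsWithNewClump (take a x) ⟧ * 1#) ∎))

  Γ⊛[𝟙⊖𝕫]≈NewClump : sumAlphabet ≈ 1# → ofZ (Γ w) ⊛ (𝟙 ⊖ 𝕫) ≋ gf endsWithNewClump
  Γ⊛[𝟙⊖𝕫]≈NewClump Σp≈1 = 𝔹.trans (ofZ-⊛[𝟙⊖𝕫] (Γ w))
    (ofZ-cong (Δ-Σ< (Pr endsWithNewClump) (Γ≈Σ<-Pr-endsWithNewClump Σp≈1)))

  Pr-U-suc+Pr-M-suc≈Pr-U : sumAlphabet ≈ 1# → ∀ n → Pr (inU w) (suc n) + Pr (inM w) (suc n) ≈ Pr (inU w) n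
  Pr-U-suc+Pr-M-suc≈Pr-U Σp≈1 n = begin
    Pr (inU w) (suc n) + Pr (inM w) (suc n)
      ≈⟨ sumL-distrib-+ (words (suc n)) _ _ ⟨
    sumL (words (suc n)) h
      ≡⟨ ≡.cong (λ t → sumL (words t) h) (ℕ.+-comm 1 n) ⟩
    sumL (words (n +ℕ 1)) h
      ≈⟨ sumL-words-+ n 1 h ⟩
    sumL (words n) (λ y → sumL (words 1) (λ d → h (y ++ d)))
      ≈⟨ sumL-cong (words n) (λ y → trans (sumL-words-∷ 0 (λ d → h (y ++ d))) (sumL-cong (allFin k) (λ c → +-identityʳ _))) ⟩
    sumL (words n) (λ y → sumL (allFin k) (λ c → h (y ++ c ∷ [])))
      ≈⟨ sumL-cong (words n) (λ y → sumL-cong (allFin k) (step y)) ⟩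
    sumL (words n) (λ y → sumL (allFin k) (λ c → (if inU w y then P y else 0#) * p c))
      ≈⟨ sumL-cong (words n) (λ y → *-distribˡ-sumL (allFin k) _ p) ⟨
    sumL (words n) (λ y → (if inU w y then P y else 0#) * sumAlphabet)
      ≈⟨ sumL-cong (words n) (λ y → trans (*-congˡ Σp≈1) (*-identityʳ _)) ⟩
    Pr (inU w) n ∎
    where
    h : Word → Carrier
    h x = (if inU w x then P x else 0#) + (if inM w x then P x else 0#)
    P-snoc : ∀ y c → P (y ++ c ∷ []) ≈ P y * p c
    P-snoc y c = trans (P-++ y (c ∷ [])) (*-congˡ (*-identityʳ _))
    step : ∀ y c → h (y ++ c ∷ []) ≈ (if inU w y then P y else 0#) * p c
    step y c with ultimateStep y c
    ... | stays-ultimate     y∈U x∈U x∉M rewrite y∈U | x∈U | x∉M = trans (+-identityʳ _) (P-snoc y c)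
    ... | becomes-minimal    y∈U x∉U x∈M rewrite y∈U | x∉U | x∈M = trans (+-identityˡ _) (P-snoc y c)
    ... | stays-non-ultimate y∉U x∉U x∉M rewrite y∉U | x∉U | x∉M = trans (+-identityʳ _) (sym (zeroˡ _))

  U⊛[𝟙⊖𝕫]≈𝟙⊖M : sumAlphabet ≈ 1# → gf (inU w) ⊛ (𝟙 ⊖ 𝕫) ≋ 𝟙 ⊖ gf (inM w)
  U⊛[𝟙⊖𝕫]≈𝟙⊖M Σp≈1 = 𝔹.trans (ofZ-⊛[𝟙⊖𝕫] (Pr (inU w))) (𝔹.trans (ofZ-cong step) (𝔹.sym (𝟙⊖ofZ (Pr (inM w)))))
    where
    step : ∀ n → Δ (Pr (inU w)) n ≈ (if n ≡ᵇ 0 then 1# else 0#) - Pr (inM w) n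
    step zero rewrite inU-[] = trans (+-identityʳ 1#) (sym (trans (+-congˡ (trans (-‿cong (+-identityʳ 0#)) -0#≈0#)) (+-identityʳ 1#)))
    step (suc n) = begin
      Pr (inU w) (suc n) - Pr (inU w) n
        ≈⟨ +-congˡ (-‿cong (Pr-U-suc+Pr-M-suc≈Pr-U Σp≈1 n)) ⟨
      Pr (inU w) (suc n) - (Pr (inU w) (suc n) + Pr (inM w) (suc n))
        ≈⟨ x-[x+y]≈-y _ _ ⟩
      - Pr (inM w) (suc n)
        ≈⟨ +-identityˡ _ ⟨
      0# - Pr (inM w) (suc n) ∎

module ClumpAlgebra {c ℓ} (S : CommutativeRing c ℓ) where
  open CommutativeRing S
  open RingLemmas S
  open SetoidReasoning setoid
  open RingProperties ring using (x[y-z]≈xy-xz; [y-z]x≈yx-zx; -‿+-comm; -‿involutive)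
  open CommSemigroupProperties *-commutativeSemigroup using (x∙yz≈y∙xz; interchange)

  [a+b]+[c+d]≈[a+d]+[b+c] : ∀ a b c d → (a + b) + (c + d) ≈ (a + d) + (b + c)
  [a+b]+[c+d]≈[a+d]+[b+c] a b c d = begin
    (a + b) + (c + d) ≈⟨ +-assoc a b (c + d) ⟩
    a + (b + (c + d)) ≈⟨ +-congˡ (+-assoc b c d) ⟨
    a + ((b + c) + d) ≈⟨ +-congˡ (+-comm (b + c) d) ⟩
    a + (d + (b + c)) ≈⟨ +-assoc a d (b + c) ⟨
    (a + d) + (b + c) ∎

  a≈[b+c]+d⇒[a-c]-d≈b : ∀ a b c d → a ≈ (b + c) + d → (a - c) - d ≈ b
  a≈[b+c]+d⇒[a-c]-d≈b a b c d a≈ = begin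
    (a - c) - d                 ≈⟨ +-congʳ (+-congʳ a≈) ⟩
    (((b + c) + d) - c) - d     ≈⟨ +-congʳ (+-assoc (b + c) d (- c)) ⟩
    ((b + c) + (d - c)) - d     ≈⟨ +-congʳ (+-congˡ (+-comm d (- c))) ⟩
    ((b + c) + (- c + d)) - d   ≈⟨ +-congʳ (+-assoc (b + c) (- c) d) ⟨
    (((b + c) - c) + d) - d     ≈⟨ x+y-y≈x _ d ⟩
    (b + c) - c                 ≈⟨ x+y-y≈x b c ⟩
    b                           ∎

  ending-solution : ∀ u r e k m → e ≈ (u * r + e * k) + u * (e * (m - k)) →
                    ((1# - u * m) + (u - 1#) * k) * e ≈ u * r
  ending-solution u r e k m e≈ = begin
    ((1# - u * m) + (u - 1#) * k) * e            ≈⟨ distribʳ e _ _ ⟩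
    (1# - u * m) * e + ((u - 1#) * k) * e        ≈⟨ +-cong first second ⟩
    (e - u * (e * m)) + (u * (e * k) - e * k)    ≈⟨ [a+b]+[c+d]≈[a+d]+[b+c] _ _ _ _ ⟩
    (e - e * k) + (- (u * (e * m)) + u * (e * k)) ≈⟨ +-congˡ third ⟨
    (e - e * k) - u * (e * (m - k))              ≈⟨ a≈[b+c]+d⇒[a-c]-d≈b e (u * r) (e * k) (u * (e * (m - k))) e≈ ⟩
    u * r                                        ∎
    where
    first : (1# - u * m) * e ≈ e - u * (e * m)
    first = trans ([y-z]x≈yx-zx e 1# (u * m))
                  (+-cong (*-identityˡ e) (-‿cong (trans (*-assoc u m e) (*-congˡ (*-comm m e)))))
    second : ((u - 1#) * k) * e ≈ u * (e * k) - e * k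
    second = trans (*-assoc _ k e) (trans ([y-z]x≈yx-zx (k * e) u 1#)
                   (+-cong (*-congˡ (*-comm k e)) (-‿cong (trans (*-identityˡ _) (*-comm k e)))))
    third : - (u * (e * (m - k))) ≈ - (u * (e * m)) + u * (e * k)
    third = begin
      - (u * (e * (m - k)))               ≈⟨ -‿cong (*-congˡ (x[y-z]≈xy-xz e m k)) ⟩
      - (u * (e * m - e * k))             ≈⟨ -‿cong (x[y-z]≈xy-xz u (e * m) (e * k)) ⟩
      - (u * (e * m) - u * (e * k))       ≈⟨ -‿+-comm _ _ ⟨
      - (u * (e * m)) - - (u * (e * k))   ≈⟨ +-congˡ (-‿involutive _) ⟩
      - (u * (e * m)) + u * (e * k)       ∎

  newClump-solution : ∀ ends r nc m k → ends ≈ r + ends * m → nc ≈ r + ends * (m - k) → nc ≈ ends * (1# - k)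
  newClump-solution ends r nc m k ends≈ nc≈ = begin
    nc                                   ≈⟨ nc≈ ⟩
    r + ends * (m - k)                   ≈⟨ +-congʳ (x≈r+xy⇒r≈x[1-y] ends r m ends≈) ⟩
    ends * (1# - m) + ends * (m - k)     ≈⟨ distribˡ ends _ _ ⟨
    ends * ((1# - m) + (m - k))          ≈⟨ *-congˡ ([1-x]+[x-y]≈1-y m k) ⟩
    ends * (1# - k)                      ∎

  Γ-over-[1-z]² : ∀ g y ends π nc k → ends * y ≈ π → nc ≈ ends * (1# - k) → g * y ≈ nc →
                  (y * y) * g ≈ π * (1# - k)
  Γ-over-[1-z]² g y ends π nc k ends-y≈π nc≈ g-y≈nc = begin
    (y * y) * g             ≈⟨ *-assoc y y g ⟩
    y * (y * g)             ≈⟨ *-congˡ (trans (*-comm y g) g-y≈nc) ⟩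
    y * nc                  ≈⟨ *-congˡ nc≈ ⟩
    y * (ends * (1# - k))   ≈⟨ *-assoc y ends _ ⟨
    (y * ends) * (1# - k)   ≈⟨ *-congʳ (trans (*-comm y ends) ends-y≈π) ⟩
    π * (1# - k)            ∎

  Γ-over-[1-M]² : ∀ g y ends π r u m k → u * y ≈ 1# - m → ends * y ≈ π → r ≈ ends * (1# - m) →
                  (y * y) * g ≈ π * (1# - k) → ((1# - m) * (1# - m)) * g ≈ (r * u) * (1# - k)
  Γ-over-[1-M]² g y ends π r u m k u-y≈ ends-y≈π r≈ y²g≈ = begin
    ((1# - m) * (1# - m)) * g       ≈⟨ *-congʳ (*-cong (sym u-y≈) (sym u-y≈)) ⟩
    ((u * y) * (u * y)) * g         ≈⟨ *-congʳ (interchange u y u y) ⟩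
    ((u * u) * (y * y)) * g         ≈⟨ *-assoc (u * u) (y * y) g ⟩
    (u * u) * ((y * y) * g)         ≈⟨ *-congˡ y²g≈ ⟩
    (u * u) * (π * (1# - k))        ≈⟨ *-assoc (u * u) π _ ⟨
    ((u * u) * π) * (1# - k)        ≈⟨ *-congʳ r-u≈ ⟩
    (r * u) * (1# - k)              ∎
    where
    r-u≈ : (u * u) * π ≈ r * u
    r-u≈ = begin
      (u * u) * π                 ≈⟨ *-assoc u u π ⟩
      u * (u * π)                 ≈⟨ *-comm u _ ⟩
      (u * π) * u                 ≈⟨ *-congʳ (*-congˡ (sym ends-y≈π)) ⟩
      (u * (ends * y)) * u        ≈⟨ *-congʳ (x∙yz≈y∙xz u ends y) ⟩
      (ends * (u * y)) * u        ≈⟨ *-congʳ (*-congˡ u-y≈) ⟩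
      (ends * (1# - m)) * u       ≈⟨ *-congʳ r≈ ⟨
      r * u                       ∎

module ClumpGeneratingFunctions {c ℓ} (R : CommutativeRing c ℓ) (k : ℕ) (p : Fin k → CommutativeRing.Carrier R)
  (a₀ : Fin k) (w₀ : List (Fin k))
  (Σp≈1 : CommutativeRing._≈_ R (Bernoulli.sumAlphabet R k p) (CommutativeRing.1# R)) where
  open CommutativeRing R using (+-identityʳ; refl)
  open Series R
  open BivariateSeries R
  open Bernoulli R k p using (gf; P; clumpGF; Γ; inN; inR; inU; inM; inK; endsWith)
  open Occurrences k a₀ w₀ using (w; endsWithNewClump)
  open ClumpDecompositions R k p a₀ w₀
  open ClumpAlgebra 𝔹
  open RingLemmas 𝔹 using (x≈r+xy⇒r≈x[1-y])
  open SetoidReasoning 𝔹.setoid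

  M-constant : gf (inM w) 0 ℙ.≈ ℙ.0#
  M-constant zero    = +-identityʳ _
  M-constant (suc i) = refl

  K-constant : gf (inK w) 0 ℙ.≈ ℙ.0#
  K-constant zero    = +-identityʳ _
  K-constant (suc i) = refl

  Mg Kg Rg Ug Ends : BS
  Mg   = gf (inM w)
  Kg   = gf (inK w)
  Rg   = gf (inR w)
  Ug   = gf (inU w)
  Ends = gf (endsWith w)

  π : BS
  π = mono (P w) (length w)

  1-z : BS
  1-z = 𝔹.1# 𝔹.- 𝕫

  ⊛³≈*³ : ∀ F G H → F ⊛ G ⊛ H 𝔹.≈ (F 𝔹.* G) 𝔹.* H
  ⊛³≈*³ F G H = 𝔹.trans (⊛≈* (F ⊛ G) H) (𝔹.*-congʳ {H} (⊛≈* F G))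

  𝟙⊖≈1- : ∀ F → 𝟙 ⊖ F 𝔹.≈ 𝔹.1# 𝔹.- F
  𝟙⊖≈1- F = 𝔹.+-congʳ {𝔹.- F} 𝟙≈1

  ⊛[𝟙⊖𝕫]≈*[1-z] : ∀ F → F ⊛ (𝟙 ⊖ 𝕫) 𝔹.≈ F 𝔹.* 1-z
  ⊛[𝟙⊖𝕫]≈*[1-z] F = 𝔹.trans (⊛≈* F (𝟙 ⊖ 𝕫)) (𝔹.*-congˡ {F} (𝟙⊖≈1- 𝕫))

  [𝟙⊖𝕫]₀≈1 : (𝟙 ⊖ 𝕫) 0 ℙ.≈ ℙ.1#
  [𝟙⊖𝕫]₀≈1 = 𝟙⊖-constant 𝕫 (λ i → refl)

  [𝟙⊖M]₀≈1 : (𝟙 ⊖ Mg) 0 ℙ.≈ ℙ.1#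
  [𝟙⊖M]₀≈1 = 𝟙⊖-constant Mg M-constant

  solve-by-recip : ∀ D X Y {D′ Y′} → D 0 ℙ.≈ ℙ.1# → D 𝔹.≈ D′ → Y 𝔹.≈ Y′ → D′ 𝔹.* X 𝔹.≈ Y′ → X ≋ Y ⊛ recip D
  solve-by-recip D X Y D₀≈1 D≈D′ Y≈Y′ D′X≈Y′ =
    divide-by-recip D X Y D₀≈1 (𝔹.trans (𝔹.*-congʳ {X} D≈D′) (𝔹.trans D′X≈Y′ (𝔹.sym Y≈Y′)))

  Ends≈R+Ends*M : Ends 𝔹.≈ Rg 𝔹.+ Ends 𝔹.* Mg
  Ends≈R+Ends*M = 𝔹.trans Ends-equation (𝔹.+-congˡ {Rg} (⊛≈* Ends Mg))

  NewClump≈R+Ends*[M-K] : gf endsWithNewClump 𝔹.≈ Rg 𝔹.+ Ends 𝔹.* (Mg 𝔹.- Kg)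
  NewClump≈R+Ends*[M-K] = 𝔹.trans NewClump-equation (𝔹.+-congˡ {Rg} (⊛≈* Ends (Mg ⊖ Kg)))

  Ending≈uR+EK+uE[M-K] : Ending 𝔹.≈ (𝕦 𝔹.* Rg 𝔹.+ Ending 𝔹.* Kg) 𝔹.+ 𝕦 𝔹.* (Ending 𝔹.* (Mg 𝔹.- Kg))
  Ending≈uR+EK+uE[M-K] = 𝔹.trans Ending-equation
    (𝔹.+-cong (𝔹.+-cong (⊛≈* 𝕦 Rg) (⊛≈* Ending Kg))
              (𝔹.trans (⊛≈* 𝕦 (Ending ⊛ (Mg ⊖ Kg))) (𝔹.*-congˡ {𝕦} (⊛≈* Ending (Mg ⊖ Kg)))))

  D₁ : BS
  D₁ = 𝟙 ⊖ 𝕦 ⊛ Mg ⊕ (𝕦 ⊖ 𝟙) ⊛ Kg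

  D₁≈ : D₁ 𝔹.≈ (𝔹.1# 𝔹.- 𝕦 𝔹.* Mg) 𝔹.+ (𝕦 𝔹.- 𝔹.1#) 𝔹.* Kg
  D₁≈ = 𝔹.+-cong (𝔹.+-cong 𝟙≈1 (𝔹.-‿cong (⊛≈* 𝕦 Mg)))
                 (𝔹.trans (⊛≈* (𝕦 ⊖ 𝟙) Kg) (𝔹.*-congʳ {Kg} (𝔹.+-congˡ {𝕦} (𝔹.-‿cong 𝟙≈1))))

  D₁-constant : D₁ 0 ℙ.≈ ℙ.1#
  D₁-constant = ℙ.trans (ℙ.+-congʳ {((𝕦 ⊖ 𝟙) ⊛ Kg) 0} (𝟙⊖-constant (𝕦 ⊛ Mg) (⊛-constant-zero 𝕦 Mg M-constant)))
                        (ℙ.trans (ℙ.+-congˡ {ℙ.1#} (⊛-constant-zero (𝕦 ⊖ 𝟙) Kg K-constant)) (ℙ.+-identityʳ ℙ.1#))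

  D₁*Occurring : ((𝔹.1# 𝔹.- 𝕦 𝔹.* Mg) 𝔹.+ (𝕦 𝔹.- 𝔹.1#) 𝔹.* Kg) 𝔹.* Occurring 𝔹.≈ (𝕦 𝔹.* Rg) 𝔹.* Ug
  D₁*Occurring = begin
    ((𝔹.1# 𝔹.- 𝕦 𝔹.* Mg) 𝔹.+ (𝕦 𝔹.- 𝔹.1#) 𝔹.* Kg) 𝔹.* Occurring
      ≈⟨ 𝔹.*-congˡ {(𝔹.1# 𝔹.- 𝕦 𝔹.* Mg) 𝔹.+ (𝕦 𝔹.- 𝔹.1#) 𝔹.* Kg} (𝔹.trans Occurring≈Ending⊛U (⊛≈* Ending Ug)) ⟩
    ((𝔹.1# 𝔹.- 𝕦 𝔹.* Mg) 𝔹.+ (𝕦 𝔹.- 𝔹.1#) 𝔹.* Kg) 𝔹.* (Ending 𝔹.* Ug)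
      ≈⟨ 𝔹.*-assoc _ Ending Ug ⟨
    (((𝔹.1# 𝔹.- 𝕦 𝔹.* Mg) 𝔹.+ (𝕦 𝔹.- 𝔹.1#) 𝔹.* Kg) 𝔹.* Ending) 𝔹.* Ug
      ≈⟨ 𝔹.*-congʳ {Ug} (ending-solution 𝕦 Rg Ending Kg Mg Ending≈uR+EK+uE[M-K]) ⟩
    (𝕦 𝔹.* Rg) 𝔹.* Ug ∎

  [1-z]²*Γ≈π[1-K] : (1-z 𝔹.* 1-z) 𝔹.* ofZ (Γ w) 𝔹.≈ π 𝔹.* (𝔹.1# 𝔹.- Kg)
  [1-z]²*Γ≈π[1-K] = Γ-over-[1-z]² (ofZ (Γ w)) 1-z Ends π (gf endsWithNewClump) Kg
    (𝔹.trans (𝔹.sym (⊛[𝟙⊖𝕫]≈*[1-z] Ends)) (Ends⊛[𝟙⊖𝕫]≈πz^m Σp≈1))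
    (newClump-solution Ends Rg (gf endsWithNewClump) Mg Kg Ends≈R+Ends*M NewClump≈R+Ends*[M-K])
    (𝔹.trans (𝔹.sym (⊛[𝟙⊖𝕫]≈*[1-z] (ofZ (Γ w)))) (Γ⊛[𝟙⊖𝕫]≈NewClump Σp≈1))

  [1-M]²*Γ≈RU[1-K] : ((𝔹.1# 𝔹.- Mg) 𝔹.* (𝔹.1# 𝔹.- Mg)) 𝔹.* ofZ (Γ w) 𝔹.≈ (Rg 𝔹.* Ug) 𝔹.* (𝔹.1# 𝔹.- Kg)
  [1-M]²*Γ≈RU[1-K] = Γ-over-[1-M]² (ofZ (Γ w)) 1-z Ends π Rg Ug Mg Kg
    (𝔹.trans (𝔹.sym (⊛[𝟙⊖𝕫]≈*[1-z] Ug)) (𝔹.trans (U⊛[𝟙⊖𝕫]≈𝟙⊖M Σp≈1) (𝟙⊖≈1- Mg)))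
    (𝔹.trans (𝔹.sym (⊛[𝟙⊖𝕫]≈*[1-z] Ends)) (Ends⊛[𝟙⊖𝕫]≈πz^m Σp≈1))
    (x≈r+xy⇒r≈x[1-y] Ends Rg Mg Ends≈R+Ends*M)
    [1-z]²*Γ≈π[1-K]

  clumpGF-formula : clumpGF w ≋ gf (inN w) ⊕ (𝕦 ⊛ Rg ⊛ Ug) ⊛ recip D₁
  clumpGF-formula = 𝔹.trans clumpGF≈N⊕Occurring (𝔹.+-congˡ {gf (inN w)}
    (solve-by-recip D₁ Occurring (𝕦 ⊛ Rg ⊛ Ug) D₁-constant D₁≈ (⊛³≈*³ 𝕦 Rg Ug) D₁*Occurring))

  Γ-formula-M : ofZ (Γ w) ≋ Rg ⊛ Ug ⊛ (𝟙 ⊖ Kg) ⊛ recip ((𝟙 ⊖ Mg) ⊛ (𝟙 ⊖ Mg))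
  Γ-formula-M = solve-by-recip ((𝟙 ⊖ Mg) ⊛ (𝟙 ⊖ Mg)) (ofZ (Γ w)) (Rg ⊛ Ug ⊛ (𝟙 ⊖ Kg))
    (⊛-constant-one (𝟙 ⊖ Mg) (𝟙 ⊖ Mg) [𝟙⊖M]₀≈1 [𝟙⊖M]₀≈1)
    (𝔹.trans (⊛≈* (𝟙 ⊖ Mg) (𝟙 ⊖ Mg)) (𝔹.*-cong (𝟙⊖≈1- Mg) (𝟙⊖≈1- Mg)))
    (𝔹.trans (⊛³≈*³ Rg Ug (𝟙 ⊖ Kg)) (𝔹.*-congˡ {Rg 𝔹.* Ug} (𝟙⊖≈1- Kg)))
    [1-M]²*Γ≈RU[1-K]

  Γ-formula-z : ofZ (Γ w) ≋ π ⊛ (𝟙 ⊖ Kg) ⊛ recip ((𝟙 ⊖ 𝕫) ⊛ (𝟙 ⊖ 𝕫))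
  Γ-formula-z = solve-by-recip ((𝟙 ⊖ 𝕫) ⊛ (𝟙 ⊖ 𝕫)) (ofZ (Γ w)) (π ⊛ (𝟙 ⊖ Kg))
    (⊛-constant-one (𝟙 ⊖ 𝕫) (𝟙 ⊖ 𝕫) [𝟙⊖𝕫]₀≈1 [𝟙⊖𝕫]₀≈1)
    (𝔹.trans (⊛≈* (𝟙 ⊖ 𝕫) (𝟙 ⊖ 𝕫)) (𝔹.*-cong (𝟙⊖≈1- 𝕫) (𝟙⊖≈1- 𝕫)))
    (𝔹.trans (⊛≈* π (𝟙 ⊖ Kg)) (𝔹.*-congˡ {π} (𝟙⊖≈1- Kg)))
    [1-z]²*Γ≈π[1-K]

mainTheorem5 : ∀ {c ℓ} (R : CommutativeRing c ℓ) (k : ℕ)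
    (p : Fin k → CommutativeRing.Carrier R) →
    let open CommutativeRing R
        open Series R
        open Bernoulli R k p
    in sumAlphabet ≈ 1# →
    (w : List (Fin k)) → ¬ (w ≡ []) →
    (clumpGF w ≋ gf (inN w) ⊕ (𝕦 ⊛ gf (inR w) ⊛ gf (inU w))
                 ⊛ recip (𝟙 ⊖ 𝕦 ⊛ gf (inM w) ⊕ (𝕦 ⊖ 𝟙) ⊛ gf (inK w)))
    × (ofZ (Γ w) ≋ gf (inR w) ⊛ gf (inU w) ⊛ (𝟙 ⊖ gf (inK w))
                   ⊛ recip ((𝟙 ⊖ gf (inM w)) ⊛ (𝟙 ⊖ gf (inM w))))
    × (ofZ (Γ w) ≋ mono (P w) (length w) ⊛ (𝟙 ⊖ gf (inK w))
                   ⊛ recip ((𝟙 ⊖ 𝕫) ⊛ (𝟙 ⊖ 𝕫)))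
mainTheorem5 R k p Σp≈1 []        []≢[] = ⊥-elim ([]≢[] ≡.refl)
mainTheorem5 R k p Σp≈1 (a₀ ∷ w₀) _     = clumpGF-formula , Γ-formula-M , Γ-formula-z
  where open ClumpGeneratingFunctions R k p a₀ w₀ Σp≈1
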